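{- There is an absolute constant $c>0$ such that the following holds. Let $G$ be any $k$-uniform hypergraph on $[n]$ with $m\ge c\,2^{ck}\epsilon^{ -2}n$ hyperedges, and let $\mathcal{I}$ be the instance with underlying hypergraph $G$ whose literal signs are chosen independently and uniformly at random. Then with high probability over the choice of signs (probability $1-o(1)$ as $n\to\infty$), for every assignment $x\in\{\pm1\}^n$ the distribution of $C(x)$, with $C$ chosen uniformly from $\mathcal{I}$, is within statistical distance $\epsilon$ of the uniform distribution on $\{\pm1\}^k$.
   Context: Each hyperedge $C=(i_1,\ldots,i_k)$ of $G$ receives a sign vector $\sigma^C\in\{\pm1\}^k$, and $C(x)=(\sigma^C_1x_{i_1},\ldots,\sigma^C_kx_{i_k})$. Random choice of literals means the vectors $\sigma^C$ are independent and uniform in $\{\pm1\}^k$.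
   Formalization: The accuracy parameter ε ranges over the positive rationals. -}

module Defs where

open import Data.Bool using (Bool; true; false; not; _∧_; _∨_; if_then_else_)
open import Data.Bool.ListAction using (any)
open import Data.Nat as ℕ using (ℕ; zero; suc; _^_)
open import Data.Integer using (+_)
open import Data.Fin using (Fin)
open import Data.Vec using (Vec; []; _∷_; lookup; map; zipWith)
open import Data.List as List using (List; []; _∷_; concatMap; foldr; filter; length)
open import Data.Rational using (ℚ; 0ℚ; _+_; _*_; _-_; ∣_∣; ½; _/_; _≤ᵇ_)
open import Relation.Binary.PropositionalEquality using (_≡_; _≢_)
open import Data.Product using (∃)

-- Signs ±1 are encoded as Bool: true = +1, false = -1.
-- Product of two signs.
smul : Bool → Bool → Bool
smul true  b = b
smul false b = not b

eqB : Bool → Bool → Bool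
eqB true  b = b
eqB false b = not b

eqVec : ∀ {k} → Vec Bool k → Vec Bool k → Bool
eqVec []       []       = true
eqVec (a ∷ as) (b ∷ bs) = eqB a b ∧ eqVec as bs

allVecs : ∀ {A : Set} → List A → (n : ℕ) → List (Vec A n)
allVecs xs zero    = [] ∷ []
allVecs xs (suc n) = concatMap (λ v → List.map (λ a → a ∷ v) xs) (allVecs xs n)

signs : List Bool
signs = true ∷ false ∷ []

Hypergraph : ℕ → ℕ → ℕ → Set
Hypergraph n k m = Vec (Vec (Fin n) k) m

-- Each hyperedge consists of k distinct vertices, and distinct hyperedges are
-- distinct as vertex sets (a simple k-uniform hypergraph).
IsKUniform : ∀ {n k m} → Hypergraph n k m → Set
IsKUniform {n} {k} {m} G =
  (∀ (j : Fin m) (s t : Fin k) → lookup (lookup G j) s ≡ lookup (lookup G j) t → s ≡ t)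
  × (∀ (i j : Fin m) → i ≢ j →
       (∀ (t : Fin k) → ∃ λ (s : Fin k) → lookup (lookup G i) t ≡ lookup (lookup G j) s) → ⊥)
  where
  open import Data.Product using (_×_)
  open import Data.Empty using (⊥)

-- Literal signs of an instance: one sign vector σ^C ∈ {±1}^k per hyperedge.
SignChoice : ℕ → ℕ → Set
SignChoice k m = Vec (Vec Bool k) m

applyC : ∀ {n k} → Vec Bool k → Vec (Fin n) k → Vec Bool n → Vec Bool k
applyC σ e x = zipWith smul σ (map (λ i → lookup x i) e)

-- a / b as a rational (0 when b = 0).
frac : ℕ → ℕ → ℚ
frac a zero    = 0ℚ
frac a (suc b) = (+ a) / suc b

ℕ→ℚ : ℕ → ℚ
ℕ→ℚ a = (+ a) / 1

count : ∀ {A : Set} → (A → Bool) → List A → ℕ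
count p = foldr (λ a r → if p a then suc r else r) 0

probCx : ∀ {n k m} → Hypergraph n k m → SignChoice k m → Vec Bool n → Vec Bool k → ℚ
probCx {m = m} G σ x y =
  frac (count (λ c → eqVec c y) (Data.Vec.toList (zipWith (λ s e → applyC s e x) σ G))) m

statDist : ∀ {n k m} → Hypergraph n k m → SignChoice k m → Vec Bool n → ℚ
statDist {k = k} G σ x =
  ½ * foldr (λ y r → ∣ probCx G σ x y - frac 1 (2 ^ k) ∣ + r) 0ℚ (allVecs signs k)

Bad : ∀ {n k m} → Hypergraph n k m → ℚ → SignChoice k m → Bool
Bad {n} G ε σ = any (λ x → not (statDist G σ x ≤ᵇ ε)) (allVecs signs n)

failProb : ∀ {n k m} → Hypergraph n k m → ℚ → ℚ
failProb {k = k} {m = m} G ε =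
  frac (count (Bad G ε) (allVecs (allVecs signs k) m)) (2 ^ (k ℕ.* m))

-- Fix an assignment x and a target y ∈ {±1}^k. For every hyperedge exactly one of the K = 2^k sign
-- vectors makes C(x) = y, so over uniform signs the number N of hyperedges with C(x) = y is
-- Binomial(m, 1/K), whatever the hyperedges are. Its exponential
-- moments are explicit, Σ_σ a^N b^(m−N) = (a + (K−1) b)^m; taking (a, b) = (r+1, r) and (r, r+1) with
-- r ≈ 1/ε, Markov's inequality and (1 + 1/M)^M ≤ (1 + 1/R)^(R+1) show that |N/m − 1/K| > 2/(Kr) for at
-- most a 2^(1−g) fraction of the sign choices as soon as K r² (g+1) ≤ m. When no target deviates, the
-- statistical distance is at most ½ · K · 2/(Kr) = 1/r ≤ ε. A union bound over the 2^n assignments and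
-- 2^k targets, with g chosen so that 2^g ≥ 2^(n+k+1)/δ, gives the theorem with c = 8. All probabilities
-- are exact counts over the 2^(km) sign choices, so the argument takes place in ℕ.

module Submission where

open import Defs
open import Data.Nat using (ℕ; _≤_; _*_; _^_)
open import Data.Rational using (ℚ; 0ℚ) renaming (_<_ to _<ℚ_; _≤_ to _≤ℚ_; _*_ to _*ℚ_)
open import Data.Product using (Σ; _×_)

open import Data.Bool using (Bool; true; false; not; _∧_; _∨_; if_then_else_; T)
open import Data.Bool.ListAction using (any)
open import Data.Bool.Properties using (¬-not; not-¬)
open import Data.Fin using (Fin)
open import Data.Integer as ℤ using (_⊖_; +≤+; +<+; +[1+_]; -[1+_])
import Data.Integer.Properties as ℤ
open import Data.List as List using (List; []; _∷_; _++_; concatMap; length; foldr)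
import Data.List.Properties as List
open import Data.List.Relation.Unary.All as All using (All; []; _∷_)
open import Data.Nat
open import Data.Nat.DivMod using (_%_; m%n<n; m≡m%n+[m/n]*n) renaming (_/_ to _div_)
open import Data.Nat.Properties
open import Data.Nat.Tactic.RingSolver using (solve-∀)
open import Data.Product using (_,_)
open import Data.Rational as Q using (1ℚ; ½; toℚᵘ; mkℚ; *<*)
import Data.Rational.Properties as Q
open import Data.Rational.Unnormalised as U using (ℚᵘ; mkℚᵘ; *≤*; *≡*)
import Data.Rational.Unnormalised.Properties as U
open import Data.Sum using (inj₁; inj₂)
open import Data.Vec using (Vec; []; _∷_; lookup; zipWith; toList)
import Data.Vec as Vec
open import Function using (_∘_)
open import Relation.Binary.PropositionalEquality
open import Relation.Nullary using (Dec; yes; no; contradiction)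

open import Algebra.Properties.CommutativeSemigroup *-commutativeSemigroup using (x∙yz≈y∙xz)

open ≤-Reasoning

*-cancelʳ-≤-pos : ∀ {m n o} → 0 < o → m * o ≤ n * o → m ≤ n
*-cancelʳ-≤-pos {m} {n} {o} o>0 = *-cancelʳ-≤ m n o {{>-nonZero o>0}}

^-pos : ∀ a n → 0 < a → 0 < a ^ n
^-pos a n a>0 = m^n>0 a {{>-nonZero a>0}} n

*-pos : ∀ {a b} → 0 < a → 0 < b → 0 < a * b
*-pos {suc a} {suc b} _ _ = z<s

^-distribʳ-* : ∀ a b n → (a * b) ^ n ≡ a ^ n * b ^ n
^-distribʳ-* a b zero    = refl
^-distribʳ-* a b (suc n) =
  trans (cong ((a * b) *_) (^-distribʳ-* a b n)) ([m*n]*[o*p]≡[m*o]*[n*p] a b (a ^ n) (b ^ n))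

divMod : ∀ m d → 0 < d → Σ ℕ λ q → Σ ℕ λ s → s < d × m ≡ s + q * d
divMod m (suc d) _ = m div suc d , m % suc d , m%n<n m (suc d) , m≡m%n+[m/n]*n m (suc d)

-- Bernoulli's inequality and the sequences (1 + 1/n)^n ↑ e ↓ (1 + 1/n)^(n+1)

-- (1 + 1/z)^n ≥ 1 + n/z
bernoulli : ∀ z n → z ^ n * (z + n) ≤ suc z ^ n * z
bernoulli z zero = ≤-reflexive (e z)
  where
  e : ∀ z → 1 * (z + 0) ≡ 1 * z
  e = solve-∀
bernoulli z (suc n) = begin
  z * z ^ n * (z + suc n)              ≤⟨ m≤m+n _ (n * z ^ n) ⟩
  z * z ^ n * (z + suc n) + n * z ^ n  ≡⟨ e₁ z n (z ^ n) ⟩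
  z ^ n * (z + n) * suc z              ≤⟨ *-monoˡ-≤ (suc z) (bernoulli z n) ⟩
  suc z ^ n * z * suc z                ≡⟨ e₂ z (suc z ^ n) ⟩
  suc z * suc z ^ n * z                ∎
  where
  e₁ : ∀ z n P → z * P * (z + suc n) + n * P ≡ P * (z + n) * suc z
  e₁ = solve-∀
  e₂ : ∀ z Q → Q * z * suc z ≡ suc z * Q * z
  e₂ = solve-∀

-- (1 + z)^n − z^n ≤ n (1 + z)^(n − 1), multiplied through by 1 + z
bernoulli-dual : ∀ z n → suc z ^ suc n ≤ z ^ n * suc z + n * suc z ^ n
bernoulli-dual z zero = ≤-reflexive (e z)
  where
  e : ∀ z → suc z * 1 ≡ 1 * suc z + 0
  e = solve-∀
bernoulli-dual z (suc n) = begin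
  suc z * (suc z * suc z ^ n)                                              ≡⟨ e₁ z (suc z ^ n) ⟩
  z * (suc z * suc z ^ n) + suc z * suc z ^ n                              ≤⟨ +-monoˡ-≤ _ (*-monoʳ-≤ z (bernoulli-dual z n)) ⟩
  z * (z ^ n * suc z + n * suc z ^ n) + suc z * suc z ^ n                  ≤⟨ m≤m+n _ (n * suc z ^ n) ⟩
  z * (z ^ n * suc z + n * suc z ^ n) + suc z * suc z ^ n + n * suc z ^ n  ≡⟨ e₂ z n (z ^ n) (suc z ^ n) ⟩
  z * z ^ n * suc z + suc n * (suc z * suc z ^ n)                          ∎
  where
  e₁ : ∀ z Q → suc z * (suc z * Q) ≡ z * (suc z * Q) + suc z * Q
  e₁ = solve-∀
  e₂ : ∀ z n P Q → z * (P * suc z + n * Q) + suc z * Q + n * Q ≡ z * P * suc z + suc n * (suc z * Q)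
  e₂ = solve-∀

-- a / b ≤ c / d, compared by cross-multiplication
record RatioLe (a b c d : ℕ) : Set where
  constructor ratioLe
  field cross : a * d ≤ c * b
open RatioLe

RatioLe-cong : ∀ {a b c d a′ b′ c′ d′} → a ≡ a′ → b ≡ b′ → c ≡ c′ → d ≡ d′ →
               RatioLe a b c d → RatioLe a′ b′ c′ d′
RatioLe-cong refl refl refl refl r = r

RatioLe-trans : ∀ {a b c d e f} → 0 < d → RatioLe a b c d → RatioLe c d e f → RatioLe a b e f
RatioLe-trans {a} {b} {c} {d} {e} {f} d>0 (ratioLe h₁) (ratioLe h₂) = ratioLe (*-cancelʳ-≤-pos d>0 (begin
  a * f * d  ≡⟨ swap a f d ⟩
  a * d * f  ≤⟨ *-monoˡ-≤ f h₁ ⟩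
  c * b * f  ≡⟨ swap c b f ⟩
  c * f * b  ≤⟨ *-monoˡ-≤ b h₂ ⟩
  e * d * b  ≡⟨ swap e d b ⟩
  e * b * d  ∎))
  where
  swap : ∀ x y z → x * y * z ≡ x * z * y
  swap = solve-∀

RatioLe-* : ∀ {a b c d a′ b′ c′ d′} → RatioLe a b c d → RatioLe a′ b′ c′ d′ →
            RatioLe (a * a′) (b * b′) (c * c′) (d * d′)
RatioLe-* {a} {b} {c} {d} {a′} {b′} {c′} {d′} (ratioLe h₁) (ratioLe h₂) = ratioLe (begin
  a * a′ * (d * d′)    ≡⟨ [m*n]*[o*p]≡[m*o]*[n*p] a a′ d d′ ⟩
  (a * d) * (a′ * d′)  ≤⟨ *-mono-≤ h₁ h₂ ⟩
  (c * b) * (c′ * b′)  ≡⟨ [m*n]*[o*p]≡[m*o]*[n*p] c b c′ b′ ⟩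
  c * c′ * (b * b′)    ∎)

RatioLe-^ : ∀ {a b c d} → RatioLe a b c d → ∀ n → RatioLe (a ^ n) (b ^ n) (c ^ n) (d ^ n)
RatioLe-^ r zero    = ratioLe ≤-refl
RatioLe-^ r (suc n) = RatioLe-* r (RatioLe-^ r n)

RatioLe-^-monoʳ : ∀ {a b} i j → b ≤ a → i ≤ j → RatioLe (a ^ i) (b ^ i) (a ^ j) (b ^ j)
RatioLe-^-monoʳ {a} {b} i j b≤a i≤j = ratioLe (begin
  a ^ i * b ^ j            ≡⟨ cong (λ e → a ^ i * b ^ e) (sym j≡i+l) ⟩
  a ^ i * b ^ (i + l)      ≡⟨ cong (a ^ i *_) (^-distribˡ-+-* b i l) ⟩
  a ^ i * (b ^ i * b ^ l)  ≤⟨ *-monoʳ-≤ (a ^ i) (*-monoʳ-≤ (b ^ i) (^-monoˡ-≤ l b≤a)) ⟩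
  a ^ i * (b ^ i * a ^ l)  ≡⟨ rotate (a ^ i) (b ^ i) (a ^ l) ⟩
  a ^ i * a ^ l * b ^ i    ≡⟨ cong (_* b ^ i) (sym (^-distribˡ-+-* a i l)) ⟩
  a ^ (i + l) * b ^ i      ≡⟨ cong (λ e → a ^ e * b ^ i) j≡i+l ⟩
  a ^ j * b ^ i            ∎)
  where
  l = j ∸ i
  j≡i+l : i + l ≡ j
  j≡i+l = m+[n∸m]≡n i≤j
  rotate : ∀ p q r → p * (q * r) ≡ p * r * q
  rotate = solve-∀

n[n+2]+1≡[n+1]² : ∀ n → suc (n * suc (suc n)) ≡ suc n * suc n
n[n+2]+1≡[n+1]² = solve-∀

[1+1/n]^[1+n]-decreasing : ∀ n → RatioLe (suc (suc n) ^ suc (suc n)) (suc n ^ suc (suc n)) (suc n ^ suc n) (n ^ suc n)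
[1+1/n]^[1+n]-decreasing n = ratioLe (*-cancelʳ-≤-pos {o = z + suc n} (<-≤-trans z<s (m≤n+m (suc n) z)) (begin
  suc (suc n) * b * a * (z + suc n)    ≡⟨ e₁ (suc (suc n)) a b (z + suc n) ⟩
  suc (suc n) * (a * b * (z + suc n))  ≤⟨ *-monoʳ-≤ (suc (suc n)) bound ⟩
  suc (suc n) * (c * c * z)            ≡⟨ e₂ (suc (suc n)) c z ⟩
  c * c * (suc (suc n) * z)            ≤⟨ *-monoʳ-≤ (c * c) (≤-trans (m≤m+n (suc (suc n) * z) 1) (≤-reflexive (e₃ n))) ⟩
  c * c * (suc n * (z + suc n))        ≡⟨ e₄ c (suc n) (z + suc n) ⟩
  c * (suc n * c) * (z + suc n)        ∎))
  where
  z = n * suc (suc n)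
  a = n ^ suc n
  b = suc (suc n) ^ suc n
  c = suc n ^ suc n
  -- Bernoulli with base z = n(n+2), since (z+1)/z = (n+1)²/(n(n+2))
  bound : a * b * (z + suc n) ≤ c * c * z
  bound = subst₂ (λ p q → p * (z + suc n) ≤ q * z) (^-distribʳ-* n (suc (suc n)) (suc n))
            (trans (cong (_^ suc n) (n[n+2]+1≡[n+1]² n)) (^-distribʳ-* (suc n) (suc n) (suc n)))
            (bernoulli z (suc n))
  e₁ : ∀ s a b w → s * b * a * w ≡ s * (a * b * w)
  e₁ = solve-∀
  e₂ : ∀ s c z → s * (c * c * z) ≡ c * c * (s * z)
  e₂ = solve-∀
  e₃ : ∀ n → suc (suc n) * (n * suc (suc n)) + 1 ≡ suc n * (n * suc (suc n) + suc n)
  e₃ = solve-∀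
  e₄ : ∀ c s w → c * c * (s * w) ≡ c * (s * c) * w
  e₄ = solve-∀

[1+1/n]^n-increasing : ∀ n → RatioLe (suc n ^ n) (n ^ n) (suc (suc n) ^ suc n) (suc n ^ suc n)
[1+1/n]^n-increasing zero     = ratioLe (s≤s z≤n)
[1+1/n]^n-increasing (suc n′) = ratioLe (*-cancelʳ-≤-pos {o = n * suc n * suc n} z<s (begin
  e * (suc n * e) * (n * suc n * suc n)  ≡⟨ e₁ e n ⟩
  n * suc n * (c * c)                    ≤⟨ bound ⟩
  a * b * (suc n * suc n)                ≡⟨ e₂ b f n ⟩
  b * f * (n * suc n * suc n)            ∎))
  where
  n = suc n′
  z = n * suc (suc n)
  a = n ^ suc n
  b = suc (suc n) ^ suc n
  c = suc n ^ suc n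
  e = suc n ^ n
  f = n ^ n
  [n+1]²-power : ∀ j → (suc n * suc n) ^ j ≡ suc n ^ j * suc n ^ j
  [n+1]²-power j = ^-distribʳ-* (suc n) (suc n) j
  -- bernoulli-dual with base z = n(n+2), since z + 1 = (n+1)²
  dual : suc n * suc n * (c * c) ≤ a * b * (suc n * suc n) + suc n * (c * c)
  dual = subst₂ _≤_
    (trans (cong (_^ suc (suc n)) (n[n+2]+1≡[n+1]² n)) (trans ([n+1]²-power (suc (suc n))) (e₀ (suc n) c)))
    (trans (cong₂ (λ p q → p * suc z + suc n * q) (^-distribʳ-* n (suc (suc n)) (suc n))
              (trans (cong (_^ suc n) (n[n+2]+1≡[n+1]² n)) ([n+1]²-power (suc n))))
           (cong (λ w → a * b * w + suc n * (c * c)) (n[n+2]+1≡[n+1]² n)))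
    (bernoulli-dual z (suc n))
    where
    e₀ : ∀ s c → s * c * (s * c) ≡ s * s * (c * c)
    e₀ = solve-∀
  bound : n * suc n * (c * c) ≤ a * b * (suc n * suc n)
  bound = +-cancelʳ-≤ (suc n * (c * c)) _ _ (subst (_≤ a * b * (suc n * suc n) + suc n * (c * c)) (e₃ n c) dual)
    where
    e₃ : ∀ n c → suc n * suc n * (c * c) ≡ n * suc n * (c * c) + suc n * (c * c)
    e₃ = solve-∀
  e₁ : ∀ e n → e * (suc n * e) * (n * suc n * suc n) ≡ n * suc n * ((suc n * e) * (suc n * e))
  e₁ = solve-∀
  e₂ : ∀ b f n → (n * f) * b * (suc n * suc n) ≡ b * f * (n * suc n * suc n)
  e₂ = solve-∀

[1+1/n]^n≤[1+1/n]^[1+n] : ∀ n → RatioLe (suc n ^ n) (n ^ n) (suc n ^ suc n) (n ^ suc n)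
[1+1/n]^n≤[1+1/n]^[1+n] n = ratioLe (begin
  e * (n * f)      ≡⟨ e₁ e n f ⟩
  n * (e * f)      ≤⟨ *-monoˡ-≤ (e * f) (n≤1+n n) ⟩
  suc n * (e * f)  ≡⟨ sym (*-assoc (suc n) e f) ⟩
  suc n * e * f    ∎)
  where
  e = suc n ^ n
  f = n ^ n
  e₁ : ∀ e n f → e * (n * f) ≡ n * (e * f)
  e₁ = solve-∀

n^n>0 : ∀ n → 0 < n ^ n
n^n>0 zero    = z<s
n^n>0 (suc n) = m^n>0 (suc n) (suc n)

[1+1/n]^n-monotone : ∀ m j → RatioLe (suc m ^ m) (m ^ m) (suc (j + m) ^ (j + m)) ((j + m) ^ (j + m))
[1+1/n]^n-monotone m zero    = ratioLe ≤-refl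
[1+1/n]^n-monotone m (suc j) =
  RatioLe-trans (n^n>0 (j + m)) ([1+1/n]^n-monotone m j) ([1+1/n]^n-increasing (j + m))

[1+1/n]^[1+n]-antitone : ∀ m j → 1 ≤ m →
  RatioLe (suc (j + m) ^ suc (j + m)) ((j + m) ^ suc (j + m)) (suc m ^ suc m) (m ^ suc m)
[1+1/n]^[1+n]-antitone m zero    _   = ratioLe ≤-refl
[1+1/n]^[1+n]-antitone m (suc j) m≥1 =
  RatioLe-trans (^-pos (j + m) (suc (j + m)) (≤-trans m≥1 (m≤n+m m j)))
    ([1+1/n]^[1+n]-decreasing (j + m)) ([1+1/n]^[1+n]-antitone m j m≥1)

[1+1/m]^m≤[1+1/n]^[1+n] : ∀ m n → 1 ≤ m → 1 ≤ n → RatioLe (suc m ^ m) (m ^ m) (suc n ^ suc n) (n ^ suc n)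
[1+1/m]^m≤[1+1/n]^[1+n] m n m≥1 n≥1 with ≤-total m n
... | inj₁ m≤n = RatioLe-trans (n^n>0 n)
  (subst (λ x → RatioLe (suc m ^ m) (m ^ m) (suc x ^ x) (x ^ x)) (m∸n+n≡m m≤n) ([1+1/n]^n-monotone m (n ∸ m)))
  ([1+1/n]^n≤[1+1/n]^[1+n] n)
... | inj₂ n≤m = RatioLe-trans (^-pos m (suc m) m≥1) ([1+1/n]^n≤[1+1/n]^[1+n] m)
  (subst (λ x → RatioLe (suc x ^ suc x) (x ^ suc x) (suc n ^ suc n) (n ^ suc n)) (m∸n+n≡m n≤m)
    ([1+1/n]^[1+n]-antitone n (m ∸ n) n≥1))

2^g≤[1+1/r]^[rg] : ∀ r g → 1 ≤ r → RatioLe (2 ^ g) 1 (suc r ^ (r * g)) (r ^ (r * g))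
2^g≤[1+1/r]^[rg] r g r≥1 = RatioLe-cong refl (^-zeroˡ g) (^-*-assoc (suc r) r g) (^-*-assoc r r g)
  (RatioLe-^ (ratioLe (subst (2 * r ^ r ≤_) (sym (*-identityʳ (suc r ^ r))) 2r^r≤[1+r]^r)) g)
  where
  2r^r≤[1+r]^r : 2 * r ^ r ≤ suc r ^ r
  2r^r≤[1+r]^r = *-cancelʳ-≤-pos {o = r} r≥1 (begin
    2 * r ^ r * r    ≡⟨ e (r ^ r) r ⟩
    r ^ r * (r + r)  ≤⟨ bernoulli r r ⟩
    suc r ^ r * r    ∎)
    where
    e : ∀ R r → 2 * R * r ≡ R * (r + r)
    e = solve-∀

upperTail-exponent : ∀ K r m t g q s → m * (r + 2) < t * (K * r) → K * r * r * suc g ≤ m →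
  s < K * r → m ≡ s + q * (K * r) → suc r * suc q + r * g ≤ t
upperTail-exponent K r m t g q s m[r+2]<tM Kr²[g+1]≤m s<M m≡s+qM =
  ≤-trans (m≤m+n (suc r * suc q + r * g) w) (≤-trans (≤-reflexive (sym split)) q[r+2]<t)
  where
  M = K * r
  q[r+2]<t : q * (r + 2) < t
  q[r+2]<t = *-cancelʳ-< M (q * (r + 2)) t (≤-<-trans (begin
    q * (r + 2) * M  ≡⟨ e₁ q r M ⟩
    q * M * (r + 2)  ≤⟨ *-monoˡ-≤ (r + 2) (subst (q * M ≤_) (sym m≡s+qM) (m≤n+m (q * M) s)) ⟩
    m * (r + 2)      ∎) m[r+2]<tM)
    where
    e₁ : ∀ q r M → q * (r + 2) * M ≡ q * M * (r + 2)
    e₁ = solve-∀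
  r[g+1]≤q : r * suc g ≤ q
  r[g+1]≤q = ≤-pred (*-cancelʳ-< M (r * suc g) (suc q) (begin-strict
    r * suc g * (K * r)  ≡⟨ e₂ K r g ⟩
    K * r * r * suc g    ≤⟨ Kr²[g+1]≤m ⟩
    m                    ≡⟨ m≡s+qM ⟩
    s + q * M            <⟨ +-monoˡ-< (q * M) s<M ⟩
    M + q * M            ∎))
    where
    e₂ : ∀ K r g → r * suc g * (K * r) ≡ K * r * r * suc g
    e₂ = solve-∀
  w = q ∸ r * suc g
  q≡w+r[g+1] : q ≡ w + r * suc g
  q≡w+r[g+1] = sym (m∸n+n≡m r[g+1]≤q)
  split : suc (q * (r + 2)) ≡ suc r * suc q + r * g + w
  split = trans (cong (λ v → suc (v * (r + 2))) q≡w+r[g+1])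
                (trans (e₃ w r g) (cong (λ v → suc r * suc v + r * g + w) (sym q≡w+r[g+1])))
    where
    e₃ : ∀ w r g → suc ((w + r * suc g) * (r + 2)) ≡ suc r * suc (w + r * suc g) + r * g + w
    e₃ = solve-∀

-- With M = K r and m ≤ M(q+1):  (1+1/M)^m ≤ ((1+1/M)^M)^(q+1) ≤ (1+1/r)^((r+1)(q+1)),
-- and 2^g ≤ (1+1/r)^(rg).
upperTail-arith : ∀ K r m t g → 1 ≤ K → 1 ≤ r → m * (r + 2) < t * (K * r) → K * r * r * suc g ≤ m →
  suc (K * r) ^ m * 2 ^ g * r ^ t ≤ (K * r) ^ m * suc r ^ t
upperTail-arith K r m t g K≥1 r≥1 m[r+2]<tM Kr²[g+1]≤m with divMod m (K * r) (*-pos K≥1 r≥1)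
... | q , s , s<M , m≡s+qM = ≤-trans (cross chain) (≤-reflexive (e₀ (suc r ^ t) ((K * r) ^ m)))
  where
  M = K * r
  M≥1 : 1 ≤ M
  M≥1 = *-pos K≥1 r≥1
  m≤M[q+1] : m ≤ M * suc q
  m≤M[q+1] = begin
    m          ≡⟨ m≡s+qM ⟩
    s + q * M  ≤⟨ +-monoˡ-≤ (q * M) (<⇒≤ s<M) ⟩
    M + q * M  ≡⟨ *-comm (suc q) M ⟩
    M * suc q  ∎
  a = suc r * suc q
  b = r * g
  grow-m : RatioLe (suc M ^ m) (M ^ m) (suc M ^ (M * suc q)) (M ^ (M * suc q))
  grow-m = RatioLe-^-monoʳ m (M * suc q) (n≤1+n M) m≤M[q+1]
  change-base : RatioLe (suc M ^ (M * suc q)) (M ^ (M * suc q)) (suc r ^ a) (r ^ a)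
  change-base = RatioLe-cong (^-*-assoc (suc M) M (suc q)) (^-*-assoc M M (suc q))
                  (^-*-assoc (suc r) (suc r) (suc q)) (^-*-assoc r (suc r) (suc q))
                  (RatioLe-^ ([1+1/m]^m≤[1+1/n]^[1+n] M r M≥1 r≥1) (suc q))
  absorb-2^g : RatioLe (suc M ^ m * 2 ^ g) (M ^ m * 1) (suc r ^ (a + b)) (r ^ (a + b))
  absorb-2^g = RatioLe-cong refl refl (sym (^-distribˡ-+-* (suc r) a b)) (sym (^-distribˡ-+-* r a b))
                 (RatioLe-* (RatioLe-trans (^-pos M (M * suc q) M≥1) grow-m change-base) (2^g≤[1+1/r]^[rg] r g r≥1))
  grow-exponent : RatioLe (suc r ^ (a + b)) (r ^ (a + b)) (suc r ^ t) (r ^ t)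
  grow-exponent = RatioLe-^-monoʳ (a + b) t (n≤1+n r)
                    (upperTail-exponent K r m t g q s m[r+2]<tM Kr²[g+1]≤m s<M m≡s+qM)
  chain : RatioLe (suc M ^ m * 2 ^ g) (M ^ m * 1) (suc r ^ t) (r ^ t)
  chain = RatioLe-trans (^-pos r (a + b) r≥1) absorb-2^g grow-exponent
  e₀ : ∀ D E → D * (E * 1) ≡ E * D
  e₀ = solve-∀

<m*[r∸2]⇒3≤r : ∀ {x} m r → x < m * (r ∸ 2) → 3 ≤ r
<m*[r∸2]⇒3≤r {x} m 0 x<0 = contradiction (subst (x <_) (*-zeroʳ m) x<0) n≮0
<m*[r∸2]⇒3≤r {x} m 1 x<0 = contradiction (subst (x <_) (*-zeroʳ m) x<0) n≮0
<m*[r∸2]⇒3≤r {x} m 2 x<0 = contradiction (subst (x <_) (*-zeroʳ m) x<0) n≮0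
<m*[r∸2]⇒3≤r m (suc (suc (suc _))) _ = s≤s (s≤s (s≤s z≤n))

lowerTail-exponent : ∀ K r m t g q s → 3 ≤ r → t * (K * r) < m * (r ∸ 2) → K * r * r * suc g ≤ m →
  s < K * suc r → m ≡ s + q * (K * suc r) → t + r * g ≤ r * q
lowerTail-exponent K r@(suc (suc (suc r′))) m t g q s (s≤s (s≤s (s≤s _))) tKr<m[r∸2] Kr²[g+1]≤m s<P m≡s+qP =
  <⇒≤ (+-cancelʳ-< r (t + r * g) (r * q) (subst₂ _<_ (e₅ t r g) (e₆ r q) t+r[g+1]<r[q+1]))
  where
  P = K * suc r
  bound : (t + r * suc g) * P ≤ r * m
  bound = *-cancelˡ-≤ r (begin
    r * ((t + r * suc g) * P)                            ≡⟨ e₁ t r g K ⟩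
    suc r * (t * (K * r)) + suc r * (K * r * r * suc g)  ≤⟨ +-mono-≤ (*-monoʳ-≤ (suc r) (<⇒≤ tKr<m[r∸2]))
                                                                     (*-monoʳ-≤ (suc r) Kr²[g+1]≤m) ⟩
    suc r * (m * suc r′) + suc r * m                     ≡⟨ e₂ r (suc r′) m ⟩
    m * (suc r * suc (suc r′))                           ≤⟨ *-monoʳ-≤ m (≤-trans (n≤1+n _) (≤-reflexive (e₃ r′))) ⟩
    m * (r * r)                                          ≡⟨ e₄ m r ⟩
    r * (r * m)                                          ∎)
    where
    e₁ : ∀ t r g K → r * ((t + r * suc g) * (K * suc r)) ≡ suc r * (t * (K * r)) + suc r * (K * r * r * suc g)
    e₁ = solve-∀
    e₂ : ∀ r S m → suc r * (m * S) + suc r * m ≡ m * (suc r * suc S)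
    e₂ = solve-∀
    e₃ : ∀ S → suc (suc (suc (suc (suc S))) * suc (suc S)) ≡ suc (suc (suc S)) * suc (suc (suc S))
    e₃ = solve-∀
    e₄ : ∀ m r → m * (r * r) ≡ r * (r * m)
    e₄ = solve-∀
  rm<r[q+1]P : r * m < r * (P + q * P)
  rm<r[q+1]P = *-monoʳ-< r (subst (_< P + q * P) (sym m≡s+qP) (+-monoˡ-< (q * P) s<P))
  t+r[g+1]<r[q+1] : t + r * suc g < r * suc q
  t+r[g+1]<r[q+1] = *-cancelʳ-< P (t + r * suc g) (r * suc q)
    (≤-<-trans bound (subst (r * m <_) (e₇ r P q) rm<r[q+1]P))
    where
    e₇ : ∀ r P q → r * (P + q * P) ≡ r * suc q * P
    e₇ = solve-∀
  e₅ : ∀ t r g → t + r * suc g ≡ t + r * g + r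
  e₅ = solve-∀
  e₆ : ∀ r q → r * suc q ≡ r * q + r
  e₆ = solve-∀

-- With M = K(r+1) − 1 and m ≥ (M+1)q:  (1+1/r)^t · 2^g ≤ (1+1/r)^(rq) ≤ ((1+1/M)^(M+1))^q ≤ (1+1/M)^m.
lowerTail-arith : ∀ K′ r m t g → 1 ≤ r → t * (suc K′ * r) < m * (r ∸ 2) → suc K′ * r * r * suc g ≤ m →
  (r + K′ * suc r) ^ m * 2 ^ g * suc r ^ t ≤ suc (r + K′ * suc r) ^ m * r ^ t
lowerTail-arith K′ r m t g r≥1 tKr<m[r∸2] Kr²[g+1]≤m with divMod m (suc (r + K′ * suc r)) z<s
... | q , s , s<P , m≡s+qP =
  ≤-trans (≤-reflexive (e₀ (suc r ^ t) (2 ^ g) (M ^ m))) (≤-trans (cross chain) (≤-reflexive (e₁ (P ^ m) (r ^ t))))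
  where
  M = r + K′ * suc r
  P = suc M
  P≡K[r+1] : P ≡ suc K′ * suc r
  P≡K[r+1] = e K′ r
    where
    e : ∀ K′ r → suc (r + K′ * suc r) ≡ suc K′ * suc r
    e = solve-∀
  M≥1 : 1 ≤ M
  M≥1 = ≤-trans r≥1 (m≤m+n r _)
  absorb-2^g : RatioLe (suc r ^ t * 2 ^ g) (r ^ t * 1) (suc r ^ (t + r * g)) (r ^ (t + r * g))
  absorb-2^g = RatioLe-cong refl refl (sym (^-distribˡ-+-* (suc r) t (r * g))) (sym (^-distribˡ-+-* r t (r * g)))
                 (RatioLe-* {suc r ^ t} {r ^ t} {suc r ^ t} {r ^ t} (ratioLe ≤-refl) (2^g≤[1+1/r]^[rg] r g r≥1))
  grow-exponent : RatioLe (suc r ^ (t + r * g)) (r ^ (t + r * g)) (suc r ^ (r * q)) (r ^ (r * q))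
  grow-exponent = RatioLe-^-monoʳ (t + r * g) (r * q) (n≤1+n r)
    (lowerTail-exponent (suc K′) r m t g q s (<m*[r∸2]⇒3≤r m r tKr<m[r∸2]) tKr<m[r∸2] Kr²[g+1]≤m
      (subst (s <_) P≡K[r+1] s<P) (subst (λ d → m ≡ s + q * d) P≡K[r+1] m≡s+qP))
  change-base : RatioLe (suc r ^ (r * q)) (r ^ (r * q)) (P ^ (P * q)) (M ^ (P * q))
  change-base = RatioLe-cong (^-*-assoc (suc r) r q) (^-*-assoc r r q) (^-*-assoc P P q) (^-*-assoc M P q)
                  (RatioLe-^ ([1+1/m]^m≤[1+1/n]^[1+n] r M r≥1 M≥1) q)
  grow-m : RatioLe (P ^ (P * q)) (M ^ (P * q)) (P ^ m) (M ^ m)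
  grow-m = RatioLe-^-monoʳ (P * q) m (n≤1+n M)
             (subst (_≤ m) (*-comm q P) (subst (q * P ≤_) (sym m≡s+qP) (m≤n+m (q * P) s)))
  chain : RatioLe (suc r ^ t * 2 ^ g) (r ^ t * 1) (P ^ m) (M ^ m)
  chain = RatioLe-trans (^-pos M (P * q) M≥1)
            (RatioLe-trans (^-pos r (r * q) r≥1) (RatioLe-trans (^-pos r (t + r * g) r≥1) absorb-2^g grow-exponent) change-base)
            grow-m
  e₀ : ∀ A B C → C * B * A ≡ A * B * C
  e₀ = solve-∀
  e₁ : ∀ D E → D * (E * 1) ≡ D * E
  e₁ = solve-∀

-- Sums and counts over lists

sumBy : ∀ {A : Set} → (A → ℕ) → List A → ℕ
sumBy f = List.foldr (λ a r → f a + r) 0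

module _ {A : Set} where

  sumBy-cong : ∀ {f g : A → ℕ} → (∀ a → f a ≡ g a) → ∀ l → sumBy f l ≡ sumBy g l
  sumBy-cong f≗g []      = refl
  sumBy-cong f≗g (a ∷ l) = cong₂ _+_ (f≗g a) (sumBy-cong f≗g l)

  sumBy-mono : ∀ {f g : A → ℕ} → (∀ a → f a ≤ g a) → ∀ l → sumBy f l ≤ sumBy g l
  sumBy-mono f≤g []      = ≤-refl
  sumBy-mono f≤g (a ∷ l) = +-mono-≤ (f≤g a) (sumBy-mono f≤g l)

  sumBy-const : ∀ c (l : List A) → sumBy (λ _ → c) l ≡ length l * c
  sumBy-const c []      = refl
  sumBy-const c (a ∷ l) = cong (c +_) (sumBy-const c l)

  sumBy-≤ : ∀ (f : A → ℕ) B → (∀ a → f a ≤ B) → ∀ l → sumBy f l ≤ length l * B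
  sumBy-≤ f B f≤B l = ≤-trans (sumBy-mono f≤B l) (≤-reflexive (sumBy-const B l))

  sumBy-+ : ∀ (f g : A → ℕ) l → sumBy (λ a → f a + g a) l ≡ sumBy f l + sumBy g l
  sumBy-+ f g []      = refl
  sumBy-+ f g (a ∷ l) = trans (cong (f a + g a +_) (sumBy-+ f g l)) (interchange (f a) (g a) (sumBy f l) (sumBy g l))
    where
    interchange : ∀ a b c d → a + b + (c + d) ≡ a + c + (b + d)
    interchange = solve-∀

  sumBy-*ʳ : ∀ (f : A → ℕ) c l → sumBy (λ a → f a * c) l ≡ sumBy f l * c
  sumBy-*ʳ f c []      = refl
  sumBy-*ʳ f c (a ∷ l) = trans (cong (f a * c +_) (sumBy-*ʳ f c l)) (sym (*-distribʳ-+ c (f a) (sumBy f l)))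

  sumBy-++ : ∀ (f : A → ℕ) xs ys → sumBy f (xs ++ ys) ≡ sumBy f xs + sumBy f ys
  sumBy-++ f []       ys = refl
  sumBy-++ f (a ∷ xs) ys = trans (cong (f a +_) (sumBy-++ f xs ys)) (sym (+-assoc (f a) _ _))

sumBy-map : ∀ {A B : Set} (f : B → ℕ) (g : A → B) l → sumBy f (List.map g l) ≡ sumBy (f ∘ g) l
sumBy-map f g []      = refl
sumBy-map f g (a ∷ l) = cong (f (g a) +_) (sumBy-map f g l)

sumBy-concatMap : ∀ {A B : Set} (f : B → ℕ) (g : A → List B) l →
                  sumBy f (concatMap g l) ≡ sumBy (λ a → sumBy f (g a)) l
sumBy-concatMap f g []      = refl
sumBy-concatMap f g (a ∷ l) = trans (sumBy-++ f (g a) (concatMap g l)) (cong (sumBy f (g a) +_) (sumBy-concatMap f g l))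

length-concatMap : ∀ {A B : Set} (g : A → List B) l → length (concatMap g l) ≡ sumBy (λ a → length (g a)) l
length-concatMap g []      = refl
length-concatMap g (a ∷ l) = trans (List.length-++ (g a)) (cong (length (g a) +_) (length-concatMap g l))

length-allVecs : ∀ {A : Set} (xs : List A) n → length (allVecs xs n) ≡ length xs ^ n
length-allVecs xs zero    = refl
length-allVecs xs (suc n) = begin-equality
  length (allVecs xs (suc n))                     ≡⟨ length-concatMap extend (allVecs xs n) ⟩
  sumBy (λ v → length (extend v)) (allVecs xs n)  ≡⟨ sumBy-cong (λ v → List.length-map (_∷ v) xs) (allVecs xs n) ⟩
  sumBy (λ _ → length xs) (allVecs xs n)          ≡⟨ sumBy-const (length xs) (allVecs xs n) ⟩
  length (allVecs xs n) * length xs               ≡⟨ cong (_* length xs) (length-allVecs xs n) ⟩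
  length xs ^ n * length xs                       ≡⟨ *-comm (length xs ^ n) (length xs) ⟩
  length xs * length xs ^ n                       ∎
  where
  extend : Vec _ n → List (Vec _ (suc n))
  extend v = List.map (_∷ v) xs

𝟙 : Bool → ℕ
𝟙 true  = 1
𝟙 false = 0

module _ {A : Set} where

  count-∷ : ∀ (p : A → Bool) a l → count p (a ∷ l) ≡ 𝟙 (p a) + count p l
  count-∷ p a l with p a
  ... | true  = refl
  ... | false = refl

  count-cong : ∀ {p q : A → Bool} → (∀ a → p a ≡ q a) → ∀ l → count p l ≡ count q l
  count-cong         p≗q []      = refl
  count-cong {p} {q} p≗q (a ∷ l) rewrite p≗q a = cong (λ r → if q a then suc r else r) (count-cong p≗q l)

  count≡sumBy-𝟙 : ∀ (p : A → Bool) l → count p l ≡ sumBy (𝟙 ∘ p) l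
  count≡sumBy-𝟙 p []      = refl
  count≡sumBy-𝟙 p (a ∷ l) = trans (count-∷ p a l) (cong (𝟙 (p a) +_) (count≡sumBy-𝟙 p l))

  count-none : ∀ (p : A → Bool) → (∀ a → p a ≢ true) → ∀ l → count p l ≡ 0
  count-none p none l = begin-equality
    count p l          ≡⟨ count≡sumBy-𝟙 p l ⟩
    sumBy (𝟙 ∘ p) l    ≡⟨ sumBy-cong (λ a → cong 𝟙 (¬-not (none a))) l ⟩
    sumBy (λ _ → 0) l  ≡⟨ sumBy-const 0 l ⟩
    length l * 0       ≡⟨ *-zeroʳ (length l) ⟩
    0                  ∎

  count≤length : ∀ (p : A → Bool) l → count p l ≤ length l
  count≤length p l = begin
    count p l        ≡⟨ count≡sumBy-𝟙 p l ⟩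
    sumBy (𝟙 ∘ p) l  ≤⟨ sumBy-≤ (𝟙 ∘ p) 1 (λ a → 𝟙≤1 (p a)) l ⟩
    length l * 1     ≡⟨ *-identityʳ (length l) ⟩
    length l         ∎
    where
    𝟙≤1 : ∀ b → 𝟙 b ≤ 1
    𝟙≤1 true  = ≤-refl
    𝟙≤1 false = z≤n

  count-mono : ∀ (p q : A → Bool) → (∀ a → p a ≡ true → q a ≡ true) → ∀ l → count p l ≤ count q l
  count-mono p q p⇒q l = begin
    count p l        ≡⟨ count≡sumBy-𝟙 p l ⟩
    sumBy (𝟙 ∘ p) l  ≤⟨ sumBy-mono (λ a → 𝟙-mono (p a) (q a) (p⇒q a)) l ⟩
    sumBy (𝟙 ∘ q) l  ≡⟨ count≡sumBy-𝟙 q l ⟨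
    count q l        ∎
    where
    𝟙-mono : ∀ a b → (a ≡ true → b ≡ true) → 𝟙 a ≤ 𝟙 b
    𝟙-mono true  b a⇒b rewrite a⇒b refl = ≤-refl
    𝟙-mono false b _   = z≤n

  count-∨ : ∀ (p q : A → Bool) l → count (λ a → p a ∨ q a) l ≤ count p l + count q l
  count-∨ p q l = begin
    count (λ a → p a ∨ q a) l          ≡⟨ count≡sumBy-𝟙 _ l ⟩
    sumBy (λ a → 𝟙 (p a ∨ q a)) l      ≤⟨ sumBy-mono (λ a → 𝟙-∨ (p a) (q a)) l ⟩
    sumBy (λ a → 𝟙 (p a) + 𝟙 (q a)) l  ≡⟨ sumBy-+ (𝟙 ∘ p) (𝟙 ∘ q) l ⟩
    sumBy (𝟙 ∘ p) l + sumBy (𝟙 ∘ q) l  ≡⟨ cong₂ _+_ (count≡sumBy-𝟙 p l) (count≡sumBy-𝟙 q l) ⟨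
    count p l + count q l              ∎
    where
    𝟙-∨ : ∀ a b → 𝟙 (a ∨ b) ≤ 𝟙 a + 𝟙 b
    𝟙-∨ true  b     = s≤s z≤n
    𝟙-∨ false true  = ≤-refl
    𝟙-∨ false false = z≤n

  -- Markov's inequality, with counts in place of probabilities
  count*≤sumBy : ∀ (p : A → Bool) (f : A → ℕ) X → (∀ a → p a ≡ true → X ≤ f a) → ∀ l → count p l * X ≤ sumBy f l
  count*≤sumBy p f X p⇒X≤f l = begin
    count p l * X                ≡⟨ cong (_* X) (count≡sumBy-𝟙 p l) ⟩
    sumBy (𝟙 ∘ p) l * X          ≡⟨ sumBy-*ʳ (𝟙 ∘ p) X l ⟨
    sumBy (λ a → 𝟙 (p a) * X) l  ≤⟨ sumBy-mono (λ a → pointwise a (p a) refl) l ⟩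
    sumBy f l                    ∎
    where
    pointwise : ∀ a b → p a ≡ b → 𝟙 b * X ≤ f a
    pointwise a true  pa = ≤-trans (≤-reflexive (+-identityʳ X)) (p⇒X≤f a pa)
    pointwise a false _  = z≤n

count-any : ∀ {A B : Set} (P : A → B → Bool) (xs : List B) (l : List A) →
            count (λ a → any (P a) xs) l ≤ sumBy (λ x → count (λ a → P a x) l) xs
count-any P []       l = ≤-reflexive (count-none _ (λ _ ()) l)
count-any P (x ∷ xs) l =
  ≤-trans (count-∨ (λ a → P a x) (λ a → any (P a) xs) l) (+-monoʳ-≤ _ (count-any P xs l))

-- Exponential moments of the number of hits

count-eqVec≡1 : ∀ k (c : Vec Bool k) → count (eqVec c) (allVecs signs k) ≡ 1
count-eqVec≡1 zero    []       = refl
count-eqVec≡1 (suc k) (c₀ ∷ c) = begin-equality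
  count p (allVecs signs (suc k))                           ≡⟨ count≡sumBy-𝟙 p (allVecs signs (suc k)) ⟩
  sumBy (𝟙 ∘ p) (allVecs signs (suc k))                     ≡⟨ sumBy-concatMap (𝟙 ∘ p) extend (allVecs signs k) ⟩
  sumBy (λ v → sumBy (𝟙 ∘ p) (extend v)) (allVecs signs k)  ≡⟨ sumBy-cong (λ v → one-extension c₀ (eqVec c v)) (allVecs signs k) ⟩
  sumBy (𝟙 ∘ eqVec c) (allVecs signs k)                     ≡⟨ count≡sumBy-𝟙 (eqVec c) (allVecs signs k) ⟨
  count (eqVec c) (allVecs signs k)                         ≡⟨ count-eqVec≡1 k c ⟩
  1                                                         ∎
  where
  p : Vec Bool (suc k) → Bool
  p = eqVec (c₀ ∷ c)
  extend : Vec Bool k → List (Vec Bool (suc k))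
  extend v = List.map (_∷ v) signs
  one-extension : ∀ c₀ b → 𝟙 (eqB c₀ true ∧ b) + (𝟙 (eqB c₀ false ∧ b) + 0) ≡ 𝟙 b
  one-extension true  true  = refl
  one-extension true  false = refl
  one-extension false true  = refl
  one-extension false false = refl

eqVec-flip : ∀ {k} (s w y : Vec Bool k) → eqVec (zipWith smul s w) y ≡ eqVec (zipWith smul y w) s
eqVec-flip []       []       []       = refl
eqVec-flip (s ∷ ss) (w ∷ ws) (y ∷ ys) = cong₂ _∧_ (eqB-flip s w y) (eqVec-flip ss ws ys)
  where
  eqB-flip : ∀ s w y → eqB (smul s w) y ≡ eqB (smul y w) s
  eqB-flip true  true  true  = refl
  eqB-flip true  true  false = refl
  eqB-flip true  false true  = refl
  eqB-flip true  false false = refl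
  eqB-flip false true  true  = refl
  eqB-flip false true  false = refl
  eqB-flip false false true  = refl
  eqB-flip false false false = refl

count-applyC≡1 : ∀ {n k} (e : Vec (Fin n) k) (x : Vec Bool n) (y : Vec Bool k) →
                 count (λ s → eqVec (applyC s e x) y) (allVecs signs k) ≡ 1
count-applyC≡1 {k = k} e x y = trans (count-cong (λ s → eqVec-flip s w y) (allVecs signs k)) (count-eqVec≡1 k (zipWith smul y w))
  where
  w = Vec.map (lookup x) e

-- Π_{c ∈ l} (a if p c else b): the exponential moment a^N b^(|l| − N) of N = count p l
weight : ∀ {A : Set} → ℕ → ℕ → (A → Bool) → List A → ℕ
weight a b p = List.foldr (λ c r → (if p c then a else b) * r) 1

module _ {A : Set} (a b : ℕ) (p : A → Bool) where

  ^-length≤weight : ∀ e → e ≤ a → e ≤ b → ∀ l → e ^ length l ≤ weight a b p l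
  ^-length≤weight e e≤a e≤b []      = ≤-refl
  ^-length≤weight e e≤a e≤b (c ∷ l) with p c
  ... | true  = *-mono-≤ e≤a (^-length≤weight e e≤a e≤b l)
  ... | false = *-mono-≤ e≤b (^-length≤weight e e≤a e≤b l)

  weight-lowerBound-many : b ≤ a → ∀ l t → t ≤ count p l → a ^ t * b ^ (length l ∸ t) ≤ weight a b p l
  weight-lowerBound-many b≤a []      zero    _ = ≤-refl
  weight-lowerBound-many b≤a (c ∷ l) t       t≤N with p c
  weight-lowerBound-many b≤a (c ∷ l) zero    _         | true =
    ≤-trans (≤-reflexive (*-identityˡ _)) (*-mono-≤ b≤a (^-length≤weight b b≤a ≤-refl l))
  weight-lowerBound-many b≤a (c ∷ l) (suc t) (s≤s t≤N) | true =
    ≤-trans (≤-reflexive (*-assoc a (a ^ t) _)) (*-monoʳ-≤ a (weight-lowerBound-many b≤a l t t≤N))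
  weight-lowerBound-many b≤a (c ∷ l) t       t≤N       | false = begin
    a ^ t * b ^ (suc (length l) ∸ t)  ≡⟨ cong (λ e → a ^ t * b ^ e) (+-∸-assoc 1 (≤-trans t≤N (count≤length p l))) ⟩
    a ^ t * (b * b ^ (length l ∸ t))  ≡⟨ x∙yz≈y∙xz (a ^ t) b _ ⟩
    b * (a ^ t * b ^ (length l ∸ t))  ≤⟨ *-monoʳ-≤ b (weight-lowerBound-many b≤a l t t≤N) ⟩
    b * weight a b p l                ∎

  weight-lowerBound-few : a ≤ b → ∀ l t → count p l ≤ t → t ≤ length l → a ^ t * b ^ (length l ∸ t) ≤ weight a b p l
  weight-lowerBound-few a≤b []      zero    _   _   = ≤-refl
  weight-lowerBound-few a≤b (c ∷ l) t       N≤t t≤L with p c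
  weight-lowerBound-few a≤b (c ∷ l) (suc t) (s≤s N≤t) (s≤s t≤L) | true =
    ≤-trans (≤-reflexive (*-assoc a (a ^ t) _)) (*-monoʳ-≤ a (weight-lowerBound-few a≤b l t N≤t t≤L))
  weight-lowerBound-few a≤b (c ∷ l) t       N≤t t≤L | false with m≤n⇒m<n∨m≡n t≤L
  ... | inj₁ (s≤s t≤L′) = begin
    a ^ t * b ^ (suc (length l) ∸ t)  ≡⟨ cong (λ e → a ^ t * b ^ e) (+-∸-assoc 1 t≤L′) ⟩
    a ^ t * (b * b ^ (length l ∸ t))  ≡⟨ x∙yz≈y∙xz (a ^ t) b _ ⟩
    b * (a ^ t * b ^ (length l ∸ t))  ≤⟨ *-monoʳ-≤ b (weight-lowerBound-few a≤b l t N≤t t≤L′) ⟩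
    b * weight a b p l                ∎
  ... | inj₂ refl = begin
    a ^ suc (length l) * b ^ (suc (length l) ∸ suc (length l))  ≡⟨ cong (λ e → a ^ suc (length l) * b ^ e) (n∸n≡0 (length l)) ⟩
    a * a ^ length l * 1                                        ≡⟨ *-identityʳ _ ⟩
    a * a ^ length l                                            ≤⟨ *-mono-≤ a≤b (^-length≤weight a ≤-refl a≤b l) ⟩
    b * weight a b p l                                          ∎

  sumBy-if : ∀ l → sumBy (λ c → if p c then a else b) l + count p l * b ≡ count p l * a + length l * b
  sumBy-if l = begin-equality
    sumBy ite l + count p l * b                      ≡⟨ cong (λ N → sumBy ite l + N * b) (count≡sumBy-𝟙 p l) ⟩
    sumBy ite l + sumBy (𝟙 ∘ p) l * b                ≡⟨ cong (sumBy ite l +_) (sumBy-*ʳ (𝟙 ∘ p) b l) ⟨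
    sumBy ite l + sumBy (λ c → 𝟙 (p c) * b) l        ≡⟨ sumBy-+ ite (λ c → 𝟙 (p c) * b) l ⟨
    sumBy (λ c → ite c + 𝟙 (p c) * b) l              ≡⟨ sumBy-cong (λ c → pointwise (p c)) l ⟩
    sumBy (λ c → 𝟙 (p c) * a + b) l                  ≡⟨ sumBy-+ (λ c → 𝟙 (p c) * a) (λ _ → b) l ⟩
    sumBy (λ c → 𝟙 (p c) * a) l + sumBy (λ _ → b) l  ≡⟨ cong₂ _+_ (sumBy-*ʳ (𝟙 ∘ p) a l) (sumBy-const b l) ⟩
    sumBy (𝟙 ∘ p) l * a + length l * b               ≡⟨ cong (λ N → N * a + length l * b) (count≡sumBy-𝟙 p l) ⟨
    count p l * a + length l * b                     ∎
    where
    ite : A → ℕ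
    ite c = if p c then a else b
    pointwise : ∀ β → (if β then a else b) + 𝟙 β * b ≡ 𝟙 β * a + b
    pointwise true  = cong₂ _+_ (sym (+-identityʳ a)) (+-identityʳ b)
    pointwise false = +-identityʳ b

outputs : ∀ {n k m} → SignChoice k m → Hypergraph n k m → Vec Bool n → List (Vec Bool k)
outputs σ G x = toList (zipWith (λ s e → applyC s e x) σ G)

length-outputs : ∀ {n k m} (σ : SignChoice k m) (G : Hypergraph n k m) x → length (outputs σ G x) ≡ m
length-outputs []      []      x = refl
length-outputs (s ∷ σ) (e ∷ G) x = cong suc (length-outputs σ G x)

hits : ∀ {n k m} → Hypergraph n k m → SignChoice k m → Vec Bool n → Vec Bool k → ℕ
hits G σ x y = count (λ c → eqVec c y) (outputs σ G x)

hits≤m : ∀ {n k m} (G : Hypergraph n k m) σ x y → hits G σ x y ≤ m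
hits≤m G σ x y = subst (hits G σ x y ≤_) (length-outputs σ G x) (count≤length _ (outputs σ G x))

-- Over uniform signs the C_j(x) hit y independently with probability 1/K, K = 2^k.
exponential-moment : ∀ {n k m} (G : Hypergraph n k m) x y a b K′ → 2 ^ k ≡ suc K′ →
  sumBy (λ σ → weight a b (λ c → eqVec c y) (outputs σ G x)) (allVecs (allVecs signs k) m) ≡ (a + K′ * b) ^ m
exponential-moment []      x y a b K′ 2^k≡K = refl
exponential-moment {k = k} {m = suc m} (e ∷ G) x y a b K′ 2^k≡K = begin-equality
  sumBy W (allVecs Ls (suc m))                        ≡⟨ sumBy-concatMap W extend (allVecs Ls m) ⟩
  sumBy (λ σ → sumBy W (extend σ)) (allVecs Ls m)     ≡⟨ sumBy-cong (λ σ → trans (sumBy-map W (_∷ σ) Ls) (sumBy-*ʳ first (W′ σ) Ls)) (allVecs Ls m) ⟩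
  sumBy (λ σ → sumBy first Ls * W′ σ) (allVecs Ls m)  ≡⟨ sumBy-cong (λ σ → cong (_* W′ σ) sum-first) (allVecs Ls m) ⟩
  sumBy (λ σ → base * W′ σ) (allVecs Ls m)            ≡⟨ sumBy-cong (λ σ → *-comm base (W′ σ)) (allVecs Ls m) ⟩
  sumBy (λ σ → W′ σ * base) (allVecs Ls m)            ≡⟨ sumBy-*ʳ W′ base (allVecs Ls m) ⟩
  sumBy W′ (allVecs Ls m) * base                      ≡⟨ cong (_* base) (exponential-moment G x y a b K′ 2^k≡K) ⟩
  base ^ m * base                                     ≡⟨ *-comm (base ^ m) base ⟩
  base * base ^ m                                     ∎
  where
  Ls = allVecs signs k
  base = a + K′ * b
  extend : SignChoice k m → List (SignChoice k (suc m))
  extend σ = List.map (_∷ σ) Ls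
  hit : Vec Bool k → Bool
  hit c = eqVec c y
  W : SignChoice k (suc m) → ℕ
  W σ = weight a b hit (outputs σ (e ∷ G) x)
  W′ : SignChoice k m → ℕ
  W′ σ = weight a b hit (outputs σ G x)
  hit₁ : Vec Bool k → Bool
  hit₁ s = hit (applyC s e x)
  first : Vec Bool k → ℕ
  first s = if hit₁ s then a else b
  one-hit : count hit₁ Ls ≡ 1
  one-hit = count-applyC≡1 e x y
  sum-first : sumBy first Ls ≡ base
  sum-first = +-cancelʳ-≡ b (sumBy first Ls) base (begin-equality
    sumBy first Ls + b                  ≡⟨ cong (sumBy first Ls +_) (*-identityˡ b) ⟨
    sumBy first Ls + 1 * b              ≡⟨ cong (λ N → sumBy first Ls + N * b) one-hit ⟨
    sumBy first Ls + count hit₁ Ls * b  ≡⟨ sumBy-if a b hit₁ Ls ⟩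
    count hit₁ Ls * a + length Ls * b   ≡⟨ cong₂ (λ N L → N * a + L * b) one-hit (trans (length-allVecs signs k) 2^k≡K) ⟩
    1 * a + suc K′ * b                  ≡⟨ e₁ a b K′ ⟩
    base + b                            ∎)
    where
    e₁ : ∀ a b K′ → 1 * a + suc K′ * b ≡ a + K′ * b + b
    e₁ = solve-∀

-- The two tails

-- N·Kr > m(r+2) and N·Kr < m(r−2): the frequency N/m of hits deviates from 1/K by more than 2/(Kr)
tooMany tooFew : ∀ {n k m} → Hypergraph n k m → ℕ → ℕ → Vec Bool n → SignChoice k m → Vec Bool k → Bool
tooMany {m = m} G K r x σ y = m * (r + 2) <ᵇ hits G σ x y * (K * r)
tooFew  {m = m} G K r x σ y = hits G σ x y * (K * r) <ᵇ m * (r ∸ 2)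

module _ {n k m} (G : Hypergraph n k m) (x : Vec Bool n) (y : Vec Bool k) (K′ : ℕ) (2^k≡K : 2 ^ k ≡ suc K′) where

  private
    σs : List (SignChoice k m)
    σs = allVecs (allVecs signs k) m
    hit : Vec Bool k → Bool
    hit c = eqVec c y

  chernoff-upper : ∀ r t (P : SignChoice k m → Bool) → (∀ σ → P σ ≡ true → t ≤ hits G σ x y) →
    count P σs * (suc r ^ t * r ^ (m ∸ t)) ≤ (suc r + K′ * r) ^ m
  chernoff-upper r t P P⇒t≤N = ≤-trans
    (count*≤sumBy P (λ σ → weight (suc r) r hit (outputs σ G x)) _
      (λ σ Pσ → subst (λ L → suc r ^ t * r ^ (L ∸ t) ≤ weight (suc r) r hit (outputs σ G x)) (length-outputs σ G x)
                  (weight-lowerBound-many (suc r) r hit (n≤1+n r) (outputs σ G x) t (P⇒t≤N σ Pσ))) σs)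
    (≤-reflexive (exponential-moment G x y (suc r) r K′ 2^k≡K))

  chernoff-lower : ∀ r t (P : SignChoice k m → Bool) → (∀ σ → P σ ≡ true → hits G σ x y ≤ t) → t ≤ m →
    count P σs * (r ^ t * suc r ^ (m ∸ t)) ≤ (r + K′ * suc r) ^ m
  chernoff-lower r t P P⇒N≤t t≤m = ≤-trans
    (count*≤sumBy P (λ σ → weight r (suc r) hit (outputs σ G x)) _
      (λ σ Pσ → subst (λ L → r ^ t * suc r ^ (L ∸ t) ≤ weight r (suc r) hit (outputs σ G x)) (length-outputs σ G x)
                  (weight-lowerBound-few r (suc r) hit (n≤1+n r) (outputs σ G x) t (P⇒N≤t σ Pσ)
                     (subst (t ≤_) (sym (length-outputs σ G x)) t≤m))) σs)
    (≤-reflexive (exponential-moment G x y r (suc r) K′ 2^k≡K))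

  upperTail-count : ∀ r g → 1 ≤ r → suc K′ * r * r * suc g ≤ m →
    count (λ σ → tooMany G (suc K′) r x σ y) σs * 2 ^ g ≤ suc K′ ^ m
  upperTail-count r g r≥1 Kr²[g+1]≤m with divMod (m * (r + 2)) (suc K′ * r) (*-pos {suc K′} z<s r≥1)
  ... | q , s , s<D , m[r+2]≡s+qD = body
    where
    K = suc K′
    D = K * r
    t = suc q
    P : SignChoice k m → Bool
    P σ = tooMany G K r x σ y
    C = count P σs
    m[r+2]<tD : m * (r + 2) < t * D
    m[r+2]<tD = subst (_< t * D) (sym m[r+2]≡s+qD) (+-monoˡ-< (q * D) s<D)
    P⇒t≤N : ∀ σ → P σ ≡ true → t ≤ hits G σ x y
    P⇒t≤N σ Pσ = *-cancelʳ-< D q (hits G σ x y) (≤-<-trans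
      (subst (q * D ≤_) (sym m[r+2]≡s+qD) (m≤n+m (q * D) _)) (<ᵇ⇒< _ _ (subst T (sym Pσ) _)))
    body : C * 2 ^ g ≤ K ^ m
    body with t ≤? m
    ... | no t≰m = ≤-trans (≤-reflexive (cong (_* 2 ^ g)
                     (count-none P (λ σ Pσ → t≰m (≤-trans (P⇒t≤N σ Pσ) (hits≤m G σ x y))) σs))) z≤n
    ... | yes t≤m = *-cancelʳ-≤-pos {o = suc r ^ t * r ^ m} (*-pos (^-pos (suc r) t z<s) (^-pos r m r≥1)) (begin
      C * 2 ^ g * (suc r ^ t * r ^ m)                  ≡⟨ cong (λ z → C * 2 ^ g * (suc r ^ t * z)) r^m-split ⟩
      C * 2 ^ g * (suc r ^ t * (r ^ (m ∸ t) * r ^ t))  ≡⟨ e₁ C (2 ^ g) (suc r ^ t) (r ^ (m ∸ t)) (r ^ t) ⟩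
      C * (suc r ^ t * r ^ (m ∸ t)) * (2 ^ g * r ^ t)  ≤⟨ *-monoˡ-≤ (2 ^ g * r ^ t) (chernoff-upper r t P P⇒t≤N) ⟩
      (suc r + K′ * r) ^ m * (2 ^ g * r ^ t)           ≡⟨ cong (λ z → z ^ m * (2 ^ g * r ^ t)) (e₂ r K′) ⟩
      suc (K * r) ^ m * (2 ^ g * r ^ t)                ≡⟨ *-assoc (suc (K * r) ^ m) (2 ^ g) (r ^ t) ⟨
      suc (K * r) ^ m * 2 ^ g * r ^ t                  ≤⟨ upperTail-arith K r m t g z<s r≥1 m[r+2]<tD Kr²[g+1]≤m ⟩
      (K * r) ^ m * suc r ^ t                          ≡⟨ cong (_* suc r ^ t) (^-distribʳ-* K r m) ⟩
      K ^ m * r ^ m * suc r ^ t                        ≡⟨ e₃ (K ^ m) (r ^ m) (suc r ^ t) ⟩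
      K ^ m * (suc r ^ t * r ^ m)                      ∎)
      where
      r^m-split : r ^ m ≡ r ^ (m ∸ t) * r ^ t
      r^m-split = trans (cong (r ^_) (sym (m∸n+n≡m t≤m))) (^-distribˡ-+-* r (m ∸ t) t)
      e₁ : ∀ C G A B R → C * G * (A * (B * R)) ≡ C * (A * B) * (G * R)
      e₁ = solve-∀
      e₂ : ∀ r K′ → suc r + K′ * r ≡ suc (suc K′ * r)
      e₂ = solve-∀
      e₃ : ∀ A B C → A * B * C ≡ A * (C * B)
      e₃ = solve-∀

  lowerTail-count : ∀ r g → 1 ≤ r → suc K′ * r * r * suc g ≤ m →
    count (λ σ → tooFew G (suc K′) r x σ y) σs * 2 ^ g ≤ suc K′ ^ m
  lowerTail-count r g r≥1 Kr²[g+1]≤m = below (m * (r ∸ 2)) ≤-refl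
    where
    K = suc K′
    D = K * r
    below : ∀ Q → Q ≤ m * (r ∸ 2) → count (λ σ → hits G σ x y * D <ᵇ Q) σs * 2 ^ g ≤ K ^ m
    below zero     _ = ≤-trans (≤-reflexive (cong (_* 2 ^ g) (count-none _ (λ _ ()) σs))) z≤n
    below (suc Q′) Q≤m[r∸2] with divMod Q′ D (*-pos {K} z<s r≥1)
    ... | t , s , s<D , Q′≡s+tD = *-cancelʳ-≤-pos {o = r ^ t * suc r ^ m} (*-pos (^-pos r t r≥1) (^-pos (suc r) m z<s)) (begin
      C * 2 ^ g * (r ^ t * suc r ^ m)                      ≡⟨ cong (λ z → C * 2 ^ g * (r ^ t * z)) [r+1]^m-split ⟩
      C * 2 ^ g * (r ^ t * (suc r ^ (m ∸ t) * suc r ^ t))  ≡⟨ e₁ C (2 ^ g) (r ^ t) (suc r ^ (m ∸ t)) (suc r ^ t) ⟩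
      C * (r ^ t * suc r ^ (m ∸ t)) * (2 ^ g * suc r ^ t)  ≤⟨ *-monoˡ-≤ (2 ^ g * suc r ^ t) (chernoff-lower r t P P⇒N≤t t≤m) ⟩
      (r + K′ * suc r) ^ m * (2 ^ g * suc r ^ t)           ≡⟨ *-assoc ((r + K′ * suc r) ^ m) (2 ^ g) (suc r ^ t) ⟨
      (r + K′ * suc r) ^ m * 2 ^ g * suc r ^ t             ≤⟨ lowerTail-arith K′ r m t g r≥1 tD<m[r∸2] Kr²[g+1]≤m ⟩
      suc (r + K′ * suc r) ^ m * r ^ t                     ≡⟨ cong (λ z → z ^ m * r ^ t) (e₂ r K′) ⟩
      (K * suc r) ^ m * r ^ t                              ≡⟨ cong (_* r ^ t) (^-distribʳ-* K (suc r) m) ⟩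
      K ^ m * suc r ^ m * r ^ t                            ≡⟨ e₃ (K ^ m) (suc r ^ m) (r ^ t) ⟩
      K ^ m * (r ^ t * suc r ^ m)                          ∎)
      where
      P : SignChoice k m → Bool
      P σ = hits G σ x y * D <ᵇ suc Q′
      C = count P σs
      tD<m[r∸2] : t * D < m * (r ∸ 2)
      tD<m[r∸2] = <-≤-trans (s≤s (subst (t * D ≤_) (sym Q′≡s+tD) (m≤n+m (t * D) s))) Q≤m[r∸2]
      t≤m : t ≤ m
      t≤m = <⇒≤ (*-cancelʳ-< D t m (<-≤-trans tD<m[r∸2] (*-monoʳ-≤ m (≤-trans (m∸n≤m r 2) (m≤n*m r K)))))
      P⇒N≤t : ∀ σ → P σ ≡ true → hits G σ x y ≤ t
      P⇒N≤t σ Pσ = ≤-pred (*-cancelʳ-< D (hits G σ x y) (suc t) (begin-strict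
        hits G σ x y * D  ≤⟨ ≤-pred (<ᵇ⇒< _ _ (subst T (sym Pσ) _)) ⟩
        Q′                ≡⟨ Q′≡s+tD ⟩
        s + t * D         <⟨ +-monoˡ-< (t * D) s<D ⟩
        D + t * D         ∎))
      [r+1]^m-split : suc r ^ m ≡ suc r ^ (m ∸ t) * suc r ^ t
      [r+1]^m-split = trans (cong (suc r ^_) (sym (m∸n+n≡m t≤m))) (^-distribˡ-+-* (suc r) (m ∸ t) t)
      e₁ : ∀ C G A B R → C * G * (A * (B * R)) ≡ C * (A * B) * (G * R)
      e₁ = solve-∀
      e₂ : ∀ r K′ → suc (r + K′ * suc r) ≡ suc K′ * suc r
      e₂ = solve-∀
      e₃ : ∀ A B C → A * B * C ≡ A * (C * B)
      e₃ = solve-∀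

-- Statistical distance

-- a / (1 + b)
fracᵘ : ℕ → ℕ → ℚᵘ
fracᵘ a b = mkℚᵘ (ℤ.+ a) b

toℚᵘ-frac : ∀ a b → toℚᵘ (frac a (suc b)) U.≃ fracᵘ a b
toℚᵘ-frac a b = Q.toℚᵘ-fromℚᵘ (fracᵘ a b)

*≤*⇒fracᵘ≤ : ∀ a b c d → a * suc d ≤ c * suc b → fracᵘ a b U.≤ fracᵘ c d
*≤*⇒fracᵘ≤ a b c d le = *≤* (subst₂ ℤ._≤_ (ℤ.pos-* a (suc d)) (ℤ.pos-* c (suc b)) (+≤+ le))

fracᵘ≤⇒*≤* : ∀ a b c d → fracᵘ a b U.≤ fracᵘ c d → a * suc d ≤ c * suc b
fracᵘ≤⇒*≤* a b c d (*≤* le) = ℤ.drop‿+≤+ (subst₂ ℤ._≤_ (sym (ℤ.pos-* a (suc d))) (sym (ℤ.pos-* c (suc b))) le)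

fracᵘ-* : ∀ a b c d → fracᵘ a b U.* fracᵘ c d U.≃ fracᵘ (a * c) (d + b * suc d)
fracᵘ-* a b c d = *≡* (cong (ℤ._* ℤ.+ suc (d + b * suc d)) (sym (ℤ.pos-* a c)))

fracᵘ-+ : ∀ a b d → fracᵘ a d U.+ fracᵘ b d U.≃ fracᵘ (a + b) d
fracᵘ-+ a b d = *≡* (trans (cong (ℤ._* ℤ.+ s) (trans (cong₂ ℤ._+_ (sym (ℤ.pos-* a s)) (sym (ℤ.pos-* b s)))
                                                    (sym (ℤ.pos-+ (a * s) (b * s)))))
                   (trans (sym (ℤ.pos-* (a * s + b * s) s))
                   (trans (cong ℤ.+_ (e a b s)) (ℤ.pos-* (a + b) (s * s)))))
  where
  s = suc d
  e : ∀ a b s → (a * s + b * s) * s ≡ (a + b) * (s * s)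
  e a b s = trans (cong (_* s) (sym (*-distribʳ-+ s a b))) (*-assoc (a + b) s s)

*≤*⇒frac≤ : ∀ a b c d → a * suc d ≤ c * suc b → frac a (suc b) Q.≤ frac c (suc d)
*≤*⇒frac≤ a b c d le = Q.toℚᵘ-cancel-≤ (U.≤-respˡ-≃ (U.≃-sym (toℚᵘ-frac a b)) (U.≤-respʳ-≃ (U.≃-sym (toℚᵘ-frac c d))
                         (*≤*⇒fracᵘ≤ a b c d le)))

-- |a/m − 1/K| ≤ c/(1+d), with the two signs of aK − m checked separately in ℕ
∣frac-frac∣≤ : ∀ a m′ K′ c d → (a * suc K′ ∸ suc m′) * suc d ≤ c * (suc m′ * suc K′) →
               (suc m′ ∸ a * suc K′) * suc d ≤ c * (suc m′ * suc K′) →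
               Q.∣ frac a (suc m′) Q.- frac 1 (suc K′) ∣ Q.≤ frac c (suc d)
∣frac-frac∣≤ a m′ K′ c d h₁ h₂ =
  Q.toℚᵘ-cancel-≤ (U.≤-respʳ-≃ (U.≃-sym (toℚᵘ-frac c d)) (U.≤-respˡ-≃ (U.≃-sym toℚᵘ-∣-∣) ∣-∣ᵘ≤))
  where
  X = frac a (suc m′)
  Y = frac 1 (suc K′)
  toℚᵘ-∣-∣ : toℚᵘ (Q.∣ X Q.- Y ∣) U.≃ U.∣ fracᵘ a m′ U.- fracᵘ 1 K′ ∣
  toℚᵘ-∣-∣ = U.≃-trans (Q.toℚᵘ-homo-∣-∣ (X Q.- Y)) (U.∣-∣-cong (U.≃-trans (Q.toℚᵘ-homo-+ X (Q.- Y))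
               (U.+-cong (toℚᵘ-frac a m′) (U.≃-trans (Q.toℚᵘ-homo‿- Y) (U.-‿cong (toℚᵘ-frac 1 K′))))))
  numerator : (ℤ.+ a ℤ.* ℤ.+ suc K′) ℤ.+ (ℤ.- (ℤ.+ 1)) ℤ.* (ℤ.+ suc m′) ≡ (a * suc K′) ⊖ suc m′
  numerator = trans (cong₂ ℤ._+_ (sym (ℤ.pos-* a (suc K′))) (ℤ.-1*i≡-i (ℤ.+ suc m′))) (ℤ.m-n≡m⊖n (a * suc K′) (suc m′))
  ∣⊖∣ : ∀ u v → (u ∸ v) * suc d ≤ c * (suc m′ * suc K′) → (v ∸ u) * suc d ≤ c * (suc m′ * suc K′) →
        ℤ.∣ u ⊖ v ∣ * suc d ≤ c * (suc m′ * suc K′)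
  ∣⊖∣ u v u∸v v∸u with ≤-total v u
  ... | inj₁ v≤u rewrite ℤ.⊖-≥ v≤u   = u∸v
  ... | inj₂ u≤v rewrite ℤ.∣⊖∣-≤ u≤v = v∸u
  ∣-∣ᵘ≤ : U.∣ fracᵘ a m′ U.- fracᵘ 1 K′ ∣ U.≤ fracᵘ c d
  ∣-∣ᵘ≤ = *≤* (subst (λ z → ℤ.+ ℤ.∣ z ∣ ℤ.* ℤ.+ suc d ℤ.≤ ℤ.+ c ℤ.* ℤ.+ suc (K′ + m′ * suc K′)) (sym numerator)
             (subst₂ ℤ._≤_ (ℤ.pos-* ℤ.∣ (a * suc K′) ⊖ suc m′ ∣ (suc d)) (ℤ.pos-* c (suc m′ * suc K′))
               (+≤+ (∣⊖∣ (a * suc K′) (suc m′) h₁ h₂))))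

foldr-+-mono : ∀ {A : Set} (f g : A → ℚ) l → All (λ y → f y Q.≤ g y) l →
               foldr (λ y r → f y Q.+ r) 0ℚ l Q.≤ foldr (λ y r → g y Q.+ r) 0ℚ l
foldr-+-mono f g []      []         = Q.≤-refl
foldr-+-mono f g (y ∷ l) (fy≤gy ∷ h) = Q.+-mono-≤ fy≤gy (foldr-+-mono f g l h)

foldr-+-frac : ∀ {A : Set} (a : A → ℕ) d l → foldr (λ y r → frac (a y) (suc d) Q.+ r) 0ℚ l ≡ frac (sumBy a l) (suc d)
foldr-+-frac a d []      = Q.toℚᵘ-injective (U.≃-trans (*≡* refl) (U.≃-sym (toℚᵘ-frac 0 d)))
foldr-+-frac a d (y ∷ l) = Q.toℚᵘ-injective (U.≃-trans (Q.toℚᵘ-homo-+ (frac (a y) (suc d)) _)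
  (U.≃-trans (U.+-cong (toℚᵘ-frac (a y) d) (U.≃-trans (U.≃-reflexive (cong toℚᵘ (foldr-+-frac a d l))) (toℚᵘ-frac (sumBy a l) d)))
  (U.≃-trans (fracᵘ-+ (a y) (sumBy a l) d) (U.≃-sym (toℚᵘ-frac (a y + sumBy a l) d)))))

½*frac≤ : ∀ A d (ε : ℚ) p q′ → toℚᵘ ε ≡ fracᵘ p q′ → A * suc q′ ≤ p * suc (d + 1 * suc d) →
          ½ Q.* frac A (suc d) Q.≤ ε
½*frac≤ A d ε p q′ ε≡p/q le = Q.toℚᵘ-cancel-≤ (U.≤-respʳ-≃ (U.≃-reflexive (sym ε≡p/q)) (U.≤-respˡ-≃ (U.≃-sym toℚᵘ-½*)
  (*≤*⇒fracᵘ≤ (1 * A) (d + 1 * suc d) p q′ (subst (λ z → z * suc q′ ≤ _) (sym (*-identityˡ A)) le))))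
  where
  toℚᵘ-½* : toℚᵘ (½ Q.* frac A (suc d)) U.≃ fracᵘ (1 * A) (d + 1 * suc d)
  toℚᵘ-½* = U.≃-trans (Q.toℚᵘ-homo-* ½ (frac A (suc d)))
              (U.≃-trans (U.*-cong {toℚᵘ ½} {fracᵘ 1 1} (*≡* refl) (toℚᵘ-frac A d)) (fracᵘ-* 1 1 A d))

ℕ→ℚ≤ℕ→ℚ*ε²⇒ : ∀ A m (ε : ℚ) p q′ → toℚᵘ ε ≡ fracᵘ p q′ → ℕ→ℚ A Q.≤ ℕ→ℚ m Q.* (ε Q.* ε) →
              A * (suc q′ * suc q′) ≤ m * (p * p)
ℕ→ℚ≤ℕ→ℚ*ε²⇒ A m ε p q′ ε≡p/q le =
  subst₂ _≤_ (cong (A *_) (cong suc (+-identityʳ _))) (*-identityʳ _) (fracᵘ≤⇒*≤* A 0 (m * (p * p)) d₂ leᵘ)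
  where
  d₁ = q′ + q′ * suc q′
  d₂ = d₁ + 0 * suc d₁
  toℚᵘ-mε² : toℚᵘ (ℕ→ℚ m Q.* (ε Q.* ε)) U.≃ fracᵘ (m * (p * p)) d₂
  toℚᵘ-mε² = U.≃-trans (Q.toℚᵘ-homo-* (ℕ→ℚ m) (ε Q.* ε))
    (U.≃-trans (U.*-cong (toℚᵘ-frac m 0) (U.≃-trans (Q.toℚᵘ-homo-* ε ε)
      (U.≃-trans (U.*-cong (U.≃-reflexive ε≡p/q) (U.≃-reflexive ε≡p/q)) (fracᵘ-* p q′ p q′))))
    (fracᵘ-* m 0 (p * p) d₁))
  leᵘ : fracᵘ A 0 U.≤ fracᵘ (m * (p * p)) d₂
  leᵘ = U.≤-respʳ-≃ toℚᵘ-mε² (U.≤-respˡ-≃ (toℚᵘ-frac A 0) (Q.toℚᵘ-mono-≤ le))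

sumBy-count-eqVec : ∀ k (L : List (Vec Bool k)) → sumBy (λ y → count (λ c → eqVec c y) L) (allVecs signs k) ≡ length L
sumBy-count-eqVec k []      = trans (sumBy-const 0 (allVecs signs k)) (*-zeroʳ (length (allVecs signs k)))
sumBy-count-eqVec k (c ∷ L) = begin-equality
  sumBy (λ y → count (λ c′ → eqVec c′ y) (c ∷ L)) Ys                     ≡⟨ sumBy-cong (λ y → count-∷ (λ c′ → eqVec c′ y) c L) Ys ⟩
  sumBy (λ y → 𝟙 (eqVec c y) + count (λ c′ → eqVec c′ y) L) Ys           ≡⟨ sumBy-+ (𝟙 ∘ eqVec c) _ Ys ⟩
  sumBy (𝟙 ∘ eqVec c) Ys + sumBy (λ y → count (λ c′ → eqVec c′ y) L) Ys  ≡⟨ cong₂ _+_ c-once (sumBy-count-eqVec k L) ⟩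
  suc (length L)                                                         ∎
  where
  Ys = allVecs signs k
  c-once : sumBy (𝟙 ∘ eqVec c) Ys ≡ 1
  c-once = trans (sym (count≡sumBy-𝟙 (eqVec c) Ys)) (count-eqVec≡1 k c)

sumBy-hits : ∀ {n k m} (G : Hypergraph n k m) σ x → sumBy (hits G σ x) (allVecs signs k) ≡ m
sumBy-hits {k = k} G σ x = trans (sumBy-count-eqVec k (outputs σ G x)) (length-outputs σ G x)

statDist≤½∑ : ∀ {n k m′} (G : Hypergraph n k (suc m′)) σ x K′ (a : Vec Bool k → ℕ) d → 2 ^ k ≡ suc K′ →
  All (λ y → Q.∣ frac (hits G σ x y) (suc m′) Q.- frac 1 (suc K′) ∣ Q.≤ frac (a y) (suc d)) (allVecs signs k) →
  statDist G σ x Q.≤ ½ Q.* frac (sumBy a (allVecs signs k)) (suc d)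
statDist≤½∑ {k = k} {m′} G σ x K′ a d 2^k≡K termwise =
  subst (λ z → statDist G σ x Q.≤ ½ Q.* z) (foldr-+-frac a d (allVecs signs k))
    (Q.*-monoˡ-≤-nonNeg ½ (foldr-+-mono (λ y → Q.∣ probCx G σ x y Q.- frac 1 (2 ^ k) ∣) (λ y → frac (a y) (suc d))
      (allVecs signs k)
      (subst (λ K → All (λ y → Q.∣ frac (hits G σ x y) (suc m′) Q.- frac 1 K ∣ Q.≤ frac (a y) (suc d)) (allVecs signs k))
        (sym 2^k≡K) termwise)))

∣frac-1/K∣≤2/[Kr] : ∀ N m′ K′ r′ → N * (suc K′ * suc r′) ≤ suc m′ * (suc r′ + 2) →
  suc m′ * (suc r′ ∸ 2) ≤ N * (suc K′ * suc r′) →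
  Q.∣ frac N (suc m′) Q.- frac 1 (suc K′) ∣ Q.≤ frac (2 * suc m′) (suc m′ * suc K′ * suc r′)
∣frac-1/K∣≤2/[Kr] N m′ K′ r′ NKr≤m[r+2] m[r∸2]≤NKr =
  ∣frac-frac∣≤ N m′ K′ (2 * m) (pred (m * K * r)) (scale {N * K ∸ m} excess) (scale {m ∸ N * K} deficit)
  where
  m = suc m′
  K = suc K′
  r = suc r′
  e₀ : ∀ N K r → N * K * r ≡ N * (K * r)
  e₀ = solve-∀
  excess : (N * K ∸ m) * r ≤ 2 * m
  excess = subst (_≤ 2 * m) (sym (*-distribʳ-∸ r (N * K) m))
    (m≤n+o⇒m∸n≤o (N * K * r) (m * r) (subst₂ _≤_ (sym (e₀ N K r)) (e₁ m r) NKr≤m[r+2]))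
    where
    e₁ : ∀ m r → m * (r + 2) ≡ m * r + 2 * m
    e₁ = solve-∀
  deficit : (m ∸ N * K) * r ≤ 2 * m
  deficit = subst (_≤ 2 * m) (sym (*-distribʳ-∸ r m (N * K))) (m≤n+o⇒m∸n≤o (m * r) (N * K * r) (begin
    m * r                ≤⟨ *-monoʳ-≤ m (m≤n+m∸n r 2) ⟩
    m * (2 + (r ∸ 2))    ≡⟨ e₂ m (r ∸ 2) ⟩
    m * (r ∸ 2) + 2 * m  ≤⟨ +-monoˡ-≤ (2 * m) (subst (m * (r ∸ 2) ≤_) (sym (e₀ N K r)) m[r∸2]≤NKr) ⟩
    N * K * r + 2 * m    ∎))
    where
    e₂ : ∀ m s → m * (2 + s) ≡ m * s + 2 * m
    e₂ = solve-∀
  scale : ∀ {z} → z * r ≤ 2 * m → z * (m * K * r) ≤ 2 * m * (m * K)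
  scale {z} zr≤2m = begin
    z * (m * K * r)  ≡⟨ e₃ z m K r ⟩
    z * r * (m * K)  ≤⟨ *-monoˡ-≤ (m * K) zr≤2m ⟩
    2 * m * (m * K)  ∎
    where
    e₃ : ∀ z m K r → z * (m * K * r) ≡ z * r * (m * K)
    e₃ = solve-∀

∣frac-1/K∣≤ : ∀ N m′ K′ → Q.∣ frac N (suc m′) Q.- frac 1 (suc K′) ∣ Q.≤ frac (N * suc K′ + suc m′) (suc m′ * suc K′)
∣frac-1/K∣≤ N m′ K′ = ∣frac-frac∣≤ N m′ K′ (N * K + m) (pred (m * K))
  (*-monoˡ-≤ (m * K) (≤-trans (m∸n≤m (N * K) m) (m≤m+n (N * K) m)))
  (*-monoˡ-≤ (m * K) (≤-trans (m∸n≤m m (N * K)) (m≤n+m m (N * K))))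
  where
  m = suc m′
  K = suc K′

deviates : ∀ {n k m} → Hypergraph n k m → ℕ → ℕ → Vec Bool n → SignChoice k m → Vec Bool k → Bool
deviates G K r x σ y = tooMany G K r x σ y ∨ tooFew G K r x σ y

statDist≤ε : ∀ {n k m′} K′ r′ (G : Hypergraph n k (suc m′)) σ x → 2 ^ k ≡ suc K′ →
  (ε : ℚ) (p q′ : ℕ) → toℚᵘ ε ≡ fracᵘ p q′ → suc q′ ≤ suc r′ * p →
  All (λ y → deviates G (suc K′) (suc r′) x σ y ≡ false) (allVecs signs k) → statDist G σ x Q.≤ ε
statDist≤ε {k = k} {m′} K′ r′ G σ x 2^k≡K ε p q′ ε≡p/q 1/r≤ε concentrated =
  Q.≤-trans (statDist≤½∑ G σ x K′ (λ _ → 2 * m) (pred (m * K * r)) 2^k≡K (All.map termwise concentrated))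
            (½*frac≤ (sumBy (λ _ → 2 * m) Ys) (pred (m * K * r)) ε p q′ ε≡p/q total)
  where
  m = suc m′
  K = suc K′
  r = suc r′
  Ys = allVecs signs k
  termwise : ∀ {y} → deviates G K r x σ y ≡ false →
             Q.∣ frac (hits G σ x y) m Q.- frac 1 K ∣ Q.≤ frac (2 * m) (m * K * r)
  termwise {y} ¬dev with tooMany G K r x σ y in many | tooFew G K r x σ y in few
  termwise {y} ()   | true  | _
  termwise {y} ()   | false | true
  termwise {y} refl | false | false =
    ∣frac-1/K∣≤2/[Kr] (hits G σ x y) m′ K′ r′ (≮⇒≥ (λ lt → contradiction (<⇒<ᵇ lt) (subst T many)))
                                            (≮⇒≥ (λ lt → contradiction (<⇒<ᵇ lt) (subst T few)))
  total : sumBy (λ _ → 2 * m) Ys * suc q′ ≤ p * (2 * (m * K * r))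
  total = begin
    sumBy (λ _ → 2 * m) Ys * suc q′  ≡⟨ cong (_* suc q′) (trans (sumBy-const (2 * m) Ys)
                                          (cong (_* (2 * m)) (trans (length-allVecs signs k) 2^k≡K))) ⟩
    K * (2 * m) * suc q′             ≤⟨ *-monoʳ-≤ (K * (2 * m)) 1/r≤ε ⟩
    K * (2 * m) * (r * p)            ≡⟨ e K m r p ⟩
    p * (2 * (m * K * r))            ∎
    where
    e : ∀ K m r p → K * (2 * m) * (r * p) ≡ p * (2 * (m * K * r))
    e = solve-∀

statDist≤1 : ∀ {n k m′} K′ (G : Hypergraph n k (suc m′)) σ x → 2 ^ k ≡ suc K′ → statDist G σ x Q.≤ 1ℚ
statDist≤1 {k = k} {m′} K′ G σ x 2^k≡K =
  Q.≤-trans (statDist≤½∑ G σ x K′ a (pred (m * K)) 2^k≡K (All.tabulate (λ {y} _ → ∣frac-1/K∣≤ (hits G σ x y) m′ K′)))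
            (½*frac≤ (sumBy a Ys) (pred (m * K)) 1ℚ 1 0 refl total)
  where
  m = suc m′
  K = suc K′
  Ys = allVecs signs k
  a : Vec Bool k → ℕ
  a y = hits G σ x y * K + m
  total : sumBy a Ys * 1 ≤ 1 * (2 * (m * K))
  total = begin
    sumBy a Ys * 1                                          ≡⟨ *-identityʳ _ ⟩
    sumBy a Ys                                              ≡⟨ sumBy-+ (λ y → hits G σ x y * K) (λ _ → m) Ys ⟩
    sumBy (λ y → hits G σ x y * K) Ys + sumBy (λ _ → m) Ys  ≡⟨ cong₂ _+_ hits-part constant-part ⟩
    m * K + K * m                                           ≡⟨ e m K ⟩
    1 * (2 * (m * K))                                       ∎
    where
    hits-part : sumBy (λ y → hits G σ x y * K) Ys ≡ m * K
    hits-part = trans (sumBy-*ʳ (hits G σ x) K Ys) (cong (_* K) (sumBy-hits G σ x))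
    constant-part : sumBy (λ _ → m) Ys ≡ K * m
    constant-part = trans (sumBy-const m Ys) (cong (_* m) (trans (length-allVecs signs k) 2^k≡K))
    e : ∀ m K → m * K + K * m ≡ 1 * (2 * (m * K))
    e = solve-∀

-- Union bound

any≡false⇒All : ∀ {A : Set} (p : A → Bool) l → any p l ≡ false → All (λ a → p a ≡ false) l
any≡false⇒All p []      _ = []
any≡false⇒All p (a ∷ l) any≡false with p a in pa
... | false = pa ∷ any≡false⇒All p l any≡false

any-none : ∀ {A : Set} (p : A → Bool) → (∀ a → p a ≡ false) → ∀ l → any p l ≡ false
any-none p none []      = refl
any-none p none (a ∷ l) rewrite none a = any-none p none l

≤⇒not-≤ᵇ≡false : ∀ {A B : ℚ} → A Q.≤ B → not (A Q.≤ᵇ B) ≡ false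
≤⇒not-≤ᵇ≡false {A} {B} A≤B with A Q.≤ᵇ B | Q.≤⇒≤ᵇ A≤B
... | true | _ = refl

module _ {n k m′} (G : Hypergraph n k (suc m′)) (ε : ℚ) (K′ : ℕ) (2^k≡K : 2 ^ k ≡ suc K′) where

  private
    m = suc m′
    K = suc K′
    σs : List (SignChoice k m)
    σs = allVecs (allVecs signs k) m
    Xs : List (Vec Bool n)
    Xs = allVecs signs n
    Ys : List (Vec Bool k)
    Ys = allVecs signs k

  count-Bad≡0 : ∀ p q′ → toℚᵘ ε ≡ fracᵘ p q′ → suc q′ ≤ p → count (Bad G ε) σs ≡ 0
  count-Bad≡0 p q′ ε≡p/q q≤p =
    count-none (Bad G ε) (λ σ → not-¬ (any-none _ (λ x → ≤⇒not-≤ᵇ≡false {statDist G σ x} {ε} (Q.≤-trans (statDist≤1 K′ G σ x 2^k≡K) 1≤ε)) Xs)) σs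
    where
    1≤ε : 1ℚ Q.≤ ε
    1≤ε = Q.toℚᵘ-cancel-≤ (U.≤-respʳ-≃ (U.≃-reflexive (sym ε≡p/q)) (*≤*⇒fracᵘ≤ 1 0 p q′ (subst₂ _≤_ (sym (*-identityˡ (suc q′))) (sym (*-identityʳ p)) q≤p)))

  count-Bad*2^g≤ : ∀ r′ g p q′ → toℚᵘ ε ≡ fracᵘ p q′ → suc q′ ≤ suc r′ * p → K * suc r′ * suc r′ * suc g ≤ m →
    count (Bad G ε) σs * 2 ^ g ≤ 2 ^ n * (2 ^ k * (2 * K ^ m))
  count-Bad*2^g≤ r′ g p q′ ε≡p/q 1/r≤ε Kr²[g+1]≤m = begin
    count (Bad G ε) σs * 2 ^ g                   ≤⟨ *-monoˡ-≤ (2 ^ g) (≤-trans (count-any far Xs σs) (sumBy-mono far≤ Xs)) ⟩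
    sumBy (λ x → sumBy (tails x) Ys) Xs * 2 ^ g  ≡⟨ sumBy-*ʳ (λ x → sumBy (tails x) Ys) (2 ^ g) Xs ⟨
    sumBy (λ x → sumBy (tails x) Ys * 2 ^ g) Xs  ≤⟨ sumBy-≤ _ (length Ys * (2 * K ^ m)) per-x Xs ⟩
    length Xs * (length Ys * (2 * K ^ m))        ≡⟨ cong₂ (λ a b → a * (b * (2 * K ^ m))) (length-allVecs signs n) (length-allVecs signs k) ⟩
    2 ^ n * (2 ^ k * (2 * K ^ m))                ∎
    where
    r = suc r′
    far : SignChoice k m → Vec Bool n → Bool
    far σ x = not (statDist G σ x Q.≤ᵇ ε)
    far⇒deviates : ∀ x σ → not (statDist G σ x Q.≤ᵇ ε) ≡ true → any (deviates G K r x σ) Ys ≡ true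
    far⇒deviates x σ far≡true = ¬-not λ none → not-¬ (≤⇒not-≤ᵇ≡false {statDist G σ x} {ε}
      (statDist≤ε K′ r′ G σ x 2^k≡K ε p q′ ε≡p/q 1/r≤ε (any≡false⇒All (deviates G K r x σ) Ys none))) far≡true
    tails : Vec Bool n → Vec Bool k → ℕ
    tails x y = count (λ σ → tooMany G K r x σ y) σs + count (λ σ → tooFew G K r x σ y) σs
    far≤ : ∀ x → count (λ σ → far σ x) σs ≤ sumBy (tails x) Ys
    far≤ x = ≤-trans (count-mono (λ σ → far σ x) (λ σ → any (deviates G K r x σ) Ys) (far⇒deviates x) σs) (≤-trans (count-any (deviates G K r x) Ys σs)
               (sumBy-mono (λ y → count-∨ (λ σ → tooMany G K r x σ y) (λ σ → tooFew G K r x σ y) σs) Ys))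
    per-y : ∀ x y → tails x y * 2 ^ g ≤ 2 * K ^ m
    per-y x y = begin
      tails x y * 2 ^ g  ≡⟨ *-distribʳ-+ (2 ^ g) (count (λ σ → tooMany G K r x σ y) σs) _ ⟩
      _                  ≤⟨ +-mono-≤ (upperTail-count G x y K′ 2^k≡K r g (s≤s z≤n) Kr²[g+1]≤m)
                                     (lowerTail-count G x y K′ 2^k≡K r g (s≤s z≤n) Kr²[g+1]≤m) ⟩
      K ^ m + K ^ m      ≡⟨ cong (K ^ m +_) (sym (+-identityʳ (K ^ m))) ⟩
      2 * K ^ m          ∎
    per-x : ∀ x → sumBy (tails x) Ys * 2 ^ g ≤ length Ys * (2 * K ^ m)
    per-x x = subst (_≤ length Ys * (2 * K ^ m)) (sumBy-*ʳ (tails x) (2 ^ g) Ys) (sumBy-≤ _ (2 * K ^ m) (per-y x) Ys)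

n<2^n : ∀ n → n < 2 ^ n
n<2^n zero    = z<s
n<2^n (suc n) = begin-strict
  1 + n          <⟨ +-mono-≤-< (m^n>0 2 n) (n<2^n n) ⟩
  2 ^ n + 2 ^ n  ≡⟨ cong (2 ^ n +_) (+-identityʳ (2 ^ n)) ⟨
  2 * 2 ^ n      ∎

2^k[n+k+D+2]≤2*2^[8k]*n : ∀ k n D → suc (suc D) ≤ n → 2 ^ k * suc (n + (k + suc D)) ≤ 2 * 2 ^ (8 * k) * n
2^k[n+k+D+2]≤2*2^[8k]*n k n D D+2≤n = begin
  K * suc (n + (k + suc D))    ≡⟨ cong (K *_) (e₁ n k D) ⟩
  K * ((n + k) + suc (suc D))  ≤⟨ *-monoʳ-≤ K (+-mono-≤ n+k≤Kn (≤-trans D+2≤n (m≤n*m n K {{m^n≢0 2 k}}))) ⟩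
  K * (K * n + K * n)          ≡⟨ e₂ K n ⟩
  2 * (K * K) * n              ≤⟨ *-monoˡ-≤ n (*-monoʳ-≤ 2 K²≤2^[8k]) ⟩
  2 * 2 ^ (8 * k) * n          ∎
  where
  K = 2 ^ k
  k≤kn : k ≤ k * n
  k≤kn = m≤m*n k n {{>-nonZero (≤-trans z<s D+2≤n)}}
  n+k≤Kn : n + k ≤ K * n
  n+k≤Kn = begin
    n + k      ≤⟨ +-monoʳ-≤ n k≤kn ⟩
    n + k * n  ≤⟨ *-monoˡ-≤ n (n<2^n k) ⟩
    K * n      ∎
  k+k≡2*k : ∀ k → k + k ≡ 2 * k
  k+k≡2*k = solve-∀
  K²≤2^[8k] : K * K ≤ 2 ^ (8 * k)
  K²≤2^[8k] = begin
    K * K        ≡⟨ ^-distribˡ-+-* 2 k k ⟨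
    2 ^ (k + k)  ≤⟨ ^-monoʳ-≤ 2 (≤-trans (≤-reflexive (k+k≡2*k k)) (*-monoˡ-≤ k {2} {8} (s≤s (s≤s z≤n)))) ⟩
    2 ^ (8 * k)  ∎
  e₁ : ∀ n k D → suc (n + (k + suc D)) ≡ (n + k) + suc (suc D)
  e₁ = solve-∀
  e₂ : ∀ K n → K * (K * n + K * n) ≡ 2 * (K * K) * n
  e₂ = solve-∀

tail-condition : ∀ k n D m r p q → 8 * 2 ^ (8 * k) * n * (q * q) ≤ m * (p * p) → 1 ≤ p → r * p ≤ 2 * q →
  suc (suc D) ≤ n → 2 ^ k * r * r * suc (n + (k + suc D)) ≤ m
tail-condition k n D m r p q hyp p≥1 rp≤2q D+2≤n = begin
  K * r * r * suc g    ≡⟨ e₁ K r (suc g) ⟩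
  r * r * (K * suc g)  ≤⟨ *-monoʳ-≤ (r * r) (2^k[n+k+D+2]≤2*2^[8k]*n k n D D+2≤n) ⟩
  r * r * (2 * E * n)  ≡⟨ e₂ r E n ⟩
  2 * E * n * r * r    ≤⟨ 2Enr²≤m ⟩
  m                    ∎
  where
  K = 2 ^ k
  E = 2 ^ (8 * k)
  g = n + (k + suc D)
  2Enr²≤m : 2 * E * n * r * r ≤ m
  2Enr²≤m = *-cancelʳ-≤-pos {o = p * p} (*-pos p≥1 p≥1) (*-cancelʳ-≤-pos {o = 4} z<s (begin
    2 * E * n * r * r * (p * p) * 4  ≡⟨ e₃ E n r p ⟩
    8 * E * n * ((r * p) * (r * p))  ≤⟨ *-monoʳ-≤ (8 * E * n) (*-mono-≤ rp≤2q rp≤2q) ⟩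
    8 * E * n * ((2 * q) * (2 * q))  ≡⟨ e₄ E n q ⟩
    8 * E * n * (q * q) * 4          ≤⟨ *-monoˡ-≤ 4 hyp ⟩
    m * (p * p) * 4                  ∎))
    where
    e₃ : ∀ E n r p → 2 * E * n * r * r * (p * p) * 4 ≡ 8 * E * n * ((r * p) * (r * p))
    e₃ = solve-∀
    e₄ : ∀ E n q → 8 * E * n * ((2 * q) * (2 * q)) ≡ 8 * E * n * (q * q) * 4
    e₄ = solve-∀
  e₁ : ∀ K r G → K * r * r * G ≡ r * r * (K * G)
  e₁ = solve-∀
  e₂ : ∀ r E n → r * r * (2 * E * n) ≡ 2 * E * n * r * r
  e₂ = solve-∀

C*2^[n+k+1+D]≤2^[n+k+1]*X⇒C*D≤X : ∀ C n k D X → C * 2 ^ (n + (k + suc D)) ≤ 2 ^ n * (2 ^ k * (2 * X)) → C * D ≤ X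
C*2^[n+k+1+D]≤2^[n+k+1]*X⇒C*D≤X C n k D X le = *-cancelʳ-≤-pos {o = 2 ^ n * (2 ^ k * 2)} 2^[n+k+1]>0 (begin
  C * D * (2 ^ n * (2 ^ k * 2))        ≡⟨ e₁ C D (2 ^ n) (2 ^ k) ⟩
  C * (2 ^ n * (2 ^ k * (2 * D)))      ≤⟨ *-monoʳ-≤ C (*-monoʳ-≤ (2 ^ n) (*-monoʳ-≤ (2 ^ k) (*-monoʳ-≤ 2 (<⇒≤ (n<2^n D))))) ⟩
  C * (2 ^ n * (2 ^ k * (2 * 2 ^ D)))  ≡⟨ cong (C *_) (trans (^-distribˡ-+-* 2 n (k + suc D)) (cong (2 ^ n *_) (^-distribˡ-+-* 2 k (suc D)))) ⟨
  C * 2 ^ (n + (k + suc D))            ≤⟨ le ⟩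
  2 ^ n * (2 ^ k * (2 * X))            ≡⟨ e₂ (2 ^ n) (2 ^ k) X ⟩
  X * (2 ^ n * (2 ^ k * 2))            ∎)
  where
  2^[n+k+1]>0 : 0 < 2 ^ n * (2 ^ k * 2)
  2^[n+k+1]>0 = *-pos (m^n>0 2 n) (*-pos (m^n>0 2 k) z<s)
  e₁ : ∀ C D A B → C * D * (A * (B * 2)) ≡ C * (A * (B * (2 * D)))
  e₁ = solve-∀
  e₂ : ∀ A B X → A * (B * (2 * X)) ≡ X * (A * (B * 2))
  e₂ = solve-∀

-- For ε = p/q ≤ 1, the integer r = 1 + ⌊q/p⌋ has 1/r ≤ ε ≤ 2/r.
1/r≤ε≤2/r : ∀ p q → 1 ≤ p → p ≤ q → Σ ℕ λ r′ → q ≤ suc r′ * p × suc r′ * p ≤ 2 * q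
1/r≤ε≤2/r p q p≥1 p≤q with divMod q p p≥1
... | t , s , s<p , q≡s+tp = t , q≤rp , rp≤2q
  where
  q≤rp : q ≤ suc t * p
  q≤rp = subst (_≤ suc t * p) (sym q≡s+tp) (+-monoˡ-≤ (t * p) (<⇒≤ s<p))
  rp≤2q : suc t * p ≤ 2 * q
  rp≤2q = ≤-trans (+-mono-≤ p≤q (subst (t * p ≤_) (sym q≡s+tp) (m≤n+m (t * p) s)))
                  (≤-reflexive (cong (q +_) (sym (+-identityʳ q))))

count-Bad*D≤K^m : ∀ {n k m′} (G : Hypergraph n k (suc m′)) (ε : ℚ) K′ → 2 ^ k ≡ suc K′ → ∀ p′ q′ d →
  toℚᵘ ε ≡ fracᵘ (suc p′) q′ → suc (suc (suc d)) ≤ n → 8 * 2 ^ (8 * k) * n * (suc q′ * suc q′) ≤ suc m′ * (suc p′ * suc p′) →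
  count (Bad G ε) (allVecs (allVecs signs k) (suc m′)) * suc d ≤ suc K′ ^ suc m′
count-Bad*D≤K^m {n} {k} {m′} G ε K′ 2^k≡K p′ q′ d ε≡p/q D+2≤n hyp = by-size (suc p′ ≤? suc q′)
  where
  C = count (Bad G ε) (allVecs (allVecs signs k) (suc m′))
  by-size : Dec (suc p′ ≤ suc q′) → C * suc d ≤ suc K′ ^ suc m′
  by-size (no  q<p) = subst (λ C → C * suc d ≤ suc K′ ^ suc m′)
                        (sym (count-Bad≡0 G ε K′ 2^k≡K (suc p′) q′ ε≡p/q (<⇒≤ (≰⇒> q<p)))) z≤n
  by-size (yes p≤q) =
    let (r′ , q≤rp , rp≤2q) = 1/r≤ε≤2/r (suc p′) (suc q′) z<s p≤q in
    C*2^[n+k+1+D]≤2^[n+k+1]*X⇒C*D≤X C n k (suc d) (suc K′ ^ suc m′)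
      (count-Bad*2^g≤ G ε K′ 2^k≡K r′ (n + (k + suc (suc d))) (suc p′) q′ ε≡p/q q≤rp
        (subst (λ K → K * suc r′ * suc r′ * suc (n + (k + suc (suc d))) ≤ suc m′) 2^k≡K
          (tail-condition k n (suc d) (suc m′) (suc r′) (suc p′) (suc q′) hyp z<s rp≤2q D+2≤n)))

failProb≤1/D : ∀ {n k m} (G : Hypergraph n k m) (ε : ℚ) p′ q′ d → toℚᵘ ε ≡ fracᵘ (suc p′) q′ →
  suc (suc (suc d)) ≤ n → 8 * 2 ^ (8 * k) * n * (suc q′ * suc q′) ≤ m * (suc p′ * suc p′) →
  failProb G ε Q.≤ frac 1 (suc d)
failProb≤1/D {n} {k} {zero} G ε p′ q′ d _ D+2≤n hyp =
  contradiction hyp (<⇒≱ (*-pos (*-pos (*-pos {8} z<s (m^n>0 2 (8 * k))) (≤-trans z<s D+2≤n)) z<s))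
failProb≤1/D {n} {k} {m@(suc m′)} G ε p′ q′ d ε≡p/q D+2≤n hyp =
  subst (λ Z → frac C Z Q.≤ frac 1 (suc d)) (suc-pred (2 ^ (k * m)) {{m^n≢0 2 (k * m)}})
    (*≤*⇒frac≤ C (pred (2 ^ (k * m))) 1 d (begin
      C * suc d                     ≤⟨ count-Bad*D≤K^m G ε K′ 2^k≡K p′ q′ d ε≡p/q D+2≤n hyp ⟩
      suc K′ ^ m                    ≡⟨ trans (cong (_^ m) (sym 2^k≡K)) (^-*-assoc 2 k m) ⟩
      2 ^ (k * m)                   ≡⟨ suc-pred (2 ^ (k * m)) {{m^n≢0 2 (k * m)}} ⟨
      suc (pred (2 ^ (k * m)))      ≡⟨ *-identityˡ _ ⟨
      1 * suc (pred (2 ^ (k * m)))  ∎))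
  where
  C = count (Bad G ε) (allVecs (allVecs signs k) m)
  K′ = pred (2 ^ k)
  2^k≡K : 2 ^ k ≡ suc K′
  2^k≡K = sym (suc-pred (2 ^ k) {{m^n≢0 2 k}})

positive⇒fracᵘ : ∀ (ε : ℚ) → 0ℚ <ℚ ε → Σ ℕ λ p′ → Σ ℕ λ q′ → toℚᵘ ε ≡ fracᵘ (suc p′) q′
positive⇒fracᵘ (mkℚ +[1+ p′ ] q′ _) _             = p′ , q′ , refl
positive⇒fracᵘ (mkℚ (ℤ.+ 0)   _  _) (*<* (+<+ ()))
positive⇒fracᵘ (mkℚ -[1+ _ ]  _  _) (*<* ())

1/[1+d]≤ : ∀ (δ : ℚ) a d → toℚᵘ δ ≡ fracᵘ (suc a) d → frac 1 (suc d) ≤ℚ δ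
1/[1+d]≤ δ a d δ≡a/d = Q.toℚᵘ-cancel-≤ (U.≤-respˡ-≃ (U.≃-sym (toℚᵘ-frac 1 d))
  (U.≤-respʳ-≃ (U.≃-reflexive (sym δ≡a/d)) (*≤*⇒fracᵘ≤ 1 d (suc a) d (*-monoˡ-≤ (suc d) {1} {suc a} (s≤s z≤n)))))

mainTheorem4 : Σ ℕ λ c → 1 ≤ c ×
    ((δ : ℚ) → 0ℚ <ℚ δ → Σ ℕ λ N → (n : ℕ) → N ≤ n →
    (k m : ℕ) (G : Hypergraph n k m) → IsKUniform G →
    (ε : ℚ) → 0ℚ <ℚ ε →
    ℕ→ℚ (c * 2 ^ (c * k) * n) ≤ℚ ℕ→ℚ m *ℚ (ε *ℚ ε) →
    failProb G ε ≤ℚ δ)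
mainTheorem4 = 8 , s≤s z≤n , λ δ δ>0 →
  let (a , d , δ≡a/d) = positive⇒fracᵘ δ δ>0 in
  suc (suc (suc d)) , λ n n≥N k m G _ ε ε>0 m≥c2^[ck]n/ε² →
    let (p′ , q′ , ε≡p/q) = positive⇒fracᵘ ε ε>0 in
    Q.≤-trans (failProb≤1/D G ε p′ q′ d ε≡p/q n≥N (ℕ→ℚ≤ℕ→ℚ*ε²⇒ (8 * 2 ^ (8 * k) * n) m ε (suc p′) q′ ε≡p/q m≥c2^[ck]n/ε²))
              (1/[1+d]≤ δ a d δ≡a/d)
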